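{- Let $n>2$ be an integer and $r\ge1$ an integer with $2^r+1<2^n$, let $s_i=(2^r+1)2^{n+i}+1$ for $i\in\mathbb{N}$, and let $S=P_{2^r+1}(n)$. Then $$\mathrm{PF}(S)=\{2s_i+s_{i+1}+\dots+s_{n+r-1}-s_0\mid 1\le i\le r\}\cup\{2s_j+s_{j+1}+\dots+s_{n-1}+s_{n+r}-s_0\mid 1\le j\le n-2\}\cup\{2s_1+s_n+s_{n+r}-s_0\},$$ and the type of $S$ is $\mathrm{t}(S)=|\mathrm{PF}(S)|=n+r-1$.
   Context: $P_{2^r+1}(n)$ is the numerical semigroup consisting of all finite non-negative integer linear combinations of $\{(2^r+1)2^{n+i}+1\mid i\in\mathbb{N}\}$. An integer $x$ is a pseudo-Frobenius number of a numerical semigroup $S$ if $x\in\mathbb{Z}\setminus S$ and $x+s\in S$ for all $s\in S\setminus\{0\}$; $\mathrm{PF}(S)$ is the set of pseudo-Frobenius numbers and its cardinality $\mathrm{t}(S)$ is the type of $S$. -}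

module Defs where

open import Data.Nat using (ℕ; zero; suc; _+_; _*_; _∸_; _^_; _≤_; _<_)
open import Data.Integer as ℤ using (ℤ; +_)
open import Data.Product using (Σ; ∃; _×_; _,_)
open import Data.Sum using (_⊎_)
open import Relation.Binary.PropositionalEquality using (_≡_)
open import Relation.Nullary using (¬_)

gen : ℕ → ℕ → ℕ → ℕ
gen m n i = m * 2 ^ (n + i) + 1

data InP (m n : ℕ) : ℕ → Set where
  none : InP m n 0
  add  : ∀ i {x} → InP m n x → InP m n (gen m n i + x)

InPℤ : ℕ → ℕ → ℤ → Set
InPℤ m n z = Σ ℕ λ x → (z ≡ + x) × InP m n x

IsPF : ℕ → ℕ → ℤ → Set
IsPF m n z = ¬ InPℤ m n z × (∀ x → InP m n x → ¬ (x ≡ 0) → InPℤ m n (z ℤ.+ + x))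

sumGen : ℕ → ℕ → ℕ → ℕ → ℕ
sumGen m n a zero = 0
sumGen m n a (suc len) = gen m n a + sumGen m n (suc a) len

PFDesc : ℕ → ℕ → ℤ → Set
PFDesc r n z =
  (Σ ℕ λ i → (1 ≤ i) × (i ≤ r) ×
     (z ≡ + (2 * s i + sumGen m n (suc i) (n + r ∸ 1 ∸ i)) ℤ.- + s 0))
  ⊎ ((Σ ℕ λ j → (1 ≤ j) × (j ≤ n ∸ 2) ×
     (z ≡ + (2 * s j + sumGen m n (suc j) (n ∸ 1 ∸ j) + s (n + r)) ℤ.- + s 0))
  ⊎ (z ≡ + (2 * s 1 + s n + s (n + r)) ℤ.- + s 0))
  where
    m = 2 ^ r + 1
    s = gen m n

{-# OPTIONS --safe #-}
-- With M = m 2ⁿ the generators are sᵢ = M 2ⁱ + 1, so a sum of j generators is M b + j with b a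
-- sum of j powers of two, i.e. popcount b ≤ j ≤ b.  Writing x = M a + k (k < M), coordinates are
-- unique in a window of width M, and x is pseudo-Frobenius iff a ≤ k + M, k < popcount a and
-- popcount (a + 2ⁱ) ≤ k + 1 whenever a + 2ⁱ ≤ k + 1 + M (the other shifts land in S because all
-- large elements do).  Writing a + 1 = 2^R (2u + 1) turns these into conditions on R, popcount u
-- and the remainder δ of k + 1 + M modulo 2^R.  For m = 2^r + 1, where M = 2^(n+r) + 2ⁿ, comparing
-- k + 1 + M = 2^R (2u + 1) + δ with the binary expansion of M leaves exactly R = n + r, R = n and
-- R = 2: the three families of the statement.

module Submission where

open import Data.Nat
open import Data.Nat.Properties
open import Data.Nat.Induction using (<-rec)
open import Data.Nat.DivMod using (m≡m%n+[m/n]*n; m%n<n)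
open import Data.Nat.Tactic.RingSolver using (solve-∀)
open import Data.Product using (Σ; _×_; _,_; proj₁; proj₂)
open import Data.List using (List; []; _∷_; _++_; length; map; applyUpTo)
open import Data.List.Properties using (length-++; length-applyUpTo; length-map)
open import Data.List.Membership.Propositional using (_∈_)
open import Data.List.Membership.Propositional.Properties
  using (∈-applyUpTo⁺; ∈-applyUpTo⁻; ∈-++⁺ˡ; ∈-++⁺ʳ; ∈-++⁻; ∈-map⁺; ∈-map⁻)
open import Data.List.Relation.Unary.Any using (here)
import Data.List.Relation.Unary.All as All
open import Data.List.Relation.Unary.AllPairs as AllPairs using (AllPairs; []; _∷_)
import Data.List.Relation.Unary.AllPairs.Properties as AllPairsₚ
open import Data.List.Relation.Unary.Unique.Propositional using (Unique)
import Data.List.Relation.Unary.Unique.Propositional.Properties as Unique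
open import Data.Sum using (inj₁; inj₂)
open import Data.Empty using (⊥-elim)
open import Relation.Nullary using (¬_; yes; no)
open import Relation.Binary.PropositionalEquality
open import Relation.Binary.Definitions using (tri<; tri≈; tri>)
open import Data.Integer as ℤ using (ℤ)
import Data.Integer.Properties as ℤP
import Data.Integer.Tactic.RingSolver as ℤ-Solver
open import Function.Bundles using (_⇔_; mk⇔; Equivalence)
import Function.Properties.Equivalence as ⇔
open import Defs

-- Binary expansions

data EvenOdd : ℕ → Set where
  even : ∀ h → EvenOdd (2 * h)
  odd  : ∀ h → EvenOdd (1 + 2 * h)

evenOdd : ∀ n → EvenOdd n
evenOdd zero = even 0
evenOdd (suc n) with evenOdd n
... | even h = odd h
... | odd h  = subst EvenOdd (*-suc 2 h) (even (suc h))

binary-induction : (P : ℕ → Set) → P 0 → (∀ h → P h → P (2 * h)) →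
                   (∀ h → P h → P (1 + 2 * h)) → ∀ n → P n
binary-induction P base double double+1 = <-rec P step
  where
  step : ∀ n → (∀ {m} → m < n → P m) → P n
  step n rec with evenOdd n
  ... | even zero    = base
  ... | even (suc h) = double (suc h) (rec (m<m+n (suc h) z<s))
  ... | odd h        = double+1 h (rec (s≤s (m≤n*m h 2)))

bit : ℕ → ℕ
bit 0             = 0
bit 1             = 1
bit (suc (suc n)) = bit n

bit-2* : ∀ h → bit (2 * h) ≡ 0
bit-2* zero    = refl
bit-2* (suc h) = trans (cong bit (*-suc 2 h)) (bit-2* h)

bit-1+2* : ∀ h → bit (1 + 2 * h) ≡ 1
bit-1+2* zero    = refl
bit-1+2* (suc h) = trans (cong (λ x → bit (suc x)) (*-suc 2 h)) (bit-1+2* h)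

⌊2*/2⌋ : ∀ h → ⌊ 2 * h /2⌋ ≡ h
⌊2*/2⌋ zero    = refl
⌊2*/2⌋ (suc h) = trans (cong ⌊_/2⌋ (*-suc 2 h)) (cong suc (⌊2*/2⌋ h))

⌊1+2*/2⌋ : ∀ h → ⌊ 1 + 2 * h /2⌋ ≡ h
⌊1+2*/2⌋ zero    = refl
⌊1+2*/2⌋ (suc h) = trans (cong (λ x → ⌊ suc x /2⌋) (*-suc 2 h)) (cong suc (⌊1+2*/2⌋ h))

-- The fuel f bounds the number of halvings; any f ≥ n gives the same value.
popcountWithin : ℕ → ℕ → ℕ
popcountWithin zero    n = 0
popcountWithin (suc f) n = bit n + popcountWithin f ⌊ n /2⌋

popcount : ℕ → ℕ
popcount n = popcountWithin n n

⌊n/2⌋≤f : ∀ {n f} → n ≤ suc f → ⌊ n /2⌋ ≤ f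
⌊n/2⌋≤f {zero}  _         = z≤n
⌊n/2⌋≤f {suc n} (s≤s n≤f) = ≤-trans (≤-pred (⌊n/2⌋<n n)) n≤f

popcountWithin-stable : ∀ f g {n} → n ≤ f → n ≤ g → popcountWithin f n ≡ popcountWithin g n
popcountWithin-stable zero    zero    _   _   = refl
popcountWithin-stable zero    (suc g) z≤n _   = popcountWithin-stable zero g z≤n z≤n
popcountWithin-stable (suc f) zero    _   z≤n = popcountWithin-stable f zero z≤n z≤n
popcountWithin-stable (suc f) (suc g) {n} n≤f n≤g =
  cong (bit n +_) (popcountWithin-stable f g (⌊n/2⌋≤f n≤f) (⌊n/2⌋≤f n≤g))

popcount-unfold : ∀ n → popcount n ≡ bit n + popcount ⌊ n /2⌋
popcount-unfold n = begin
  popcountWithin n n                          ≡⟨ popcountWithin-stable n (suc n) ≤-refl (n≤1+n n) ⟩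
  bit n + popcountWithin n ⌊ n /2⌋            ≡⟨ cong (bit n +_) (popcountWithin-stable n _ (⌊n/2⌋≤n n) ≤-refl) ⟩
  bit n + popcountWithin ⌊ n /2⌋ ⌊ n /2⌋      ∎
  where open ≡-Reasoning

popcount-2* : ∀ h → popcount (2 * h) ≡ popcount h
popcount-2* h = trans (popcount-unfold (2 * h)) (cong₂ _+_ (bit-2* h) (cong popcount (⌊2*/2⌋ h)))

popcount-1+2* : ∀ h → popcount (1 + 2 * h) ≡ suc (popcount h)
popcount-1+2* h = trans (popcount-unfold (1 + 2 * h)) (cong₂ _+_ (bit-1+2* h) (cong popcount (⌊1+2*/2⌋ h)))

popcount-suc≤ : ∀ n → popcount (suc n) ≤ suc (popcount n)
popcount-suc≤ = binary-induction _ ≤-refl double double+1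
  where
  double : ∀ h → popcount (suc h) ≤ suc (popcount h) → popcount (suc (2 * h)) ≤ suc (popcount (2 * h))
  double h _ = ≤-reflexive (trans (popcount-1+2* h) (cong suc (sym (popcount-2* h))))
  double+1 : ∀ h → popcount (suc h) ≤ suc (popcount h) → popcount (2 + 2 * h) ≤ suc (popcount (1 + 2 * h))
  double+1 h ih = begin
    popcount (2 + 2 * h)      ≡⟨ cong popcount (sym (*-suc 2 h)) ⟩
    popcount (2 * suc h)      ≡⟨ popcount-2* (suc h) ⟩
    popcount (suc h)          ≤⟨ ih ⟩
    suc (popcount h)          ≡⟨ sym (popcount-1+2* h) ⟩
    popcount (1 + 2 * h)      ≤⟨ n≤1+n _ ⟩
    suc (popcount (1 + 2 * h)) ∎
    where open ≤-Reasoning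

popcount<2^ : ∀ K {n} → n < 2 ^ K → popcount n ≤ K
popcount<2^ zero    {zero}  _         = z≤n
popcount<2^ zero    {suc n} (s≤s ())
popcount<2^ (suc K) {n}     n<2^K+1 with evenOdd n
... | even h = begin
  popcount (2 * h) ≡⟨ popcount-2* h ⟩
  popcount h       ≤⟨ popcount<2^ K (*-cancelˡ-< 2 h (2 ^ K) n<2^K+1) ⟩
  K                ≤⟨ n≤1+n K ⟩
  suc K            ∎
  where open ≤-Reasoning
... | odd h = begin
  popcount (1 + 2 * h) ≡⟨ popcount-1+2* h ⟩
  suc (popcount h)     ≤⟨ s≤s (popcount<2^ K (*-cancelˡ-< 2 h (2 ^ K) (<-trans (n<1+n _) n<2^K+1))) ⟩
  suc K                ∎
  where open ≤-Reasoning

popcount-2^*+ : ∀ K x {y} → y < 2 ^ K → popcount (2 ^ K * x + y) ≡ popcount x + popcount y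
popcount-2^*+ zero    x {zero} _ =
  trans (cong popcount (trans (+-identityʳ _) (*-identityˡ x))) (sym (+-identityʳ _))
popcount-2^*+ zero    x {suc y} (s≤s ())
popcount-2^*+ (suc K) x {y} y< with evenOdd y
... | even h = begin
  popcount (2 ^ suc K * x + 2 * h) ≡⟨ cong popcount (shift-even (2 ^ K) x h) ⟩
  popcount (2 * (2 ^ K * x + h))   ≡⟨ popcount-2* (2 ^ K * x + h) ⟩
  popcount (2 ^ K * x + h)         ≡⟨ popcount-2^*+ K x (*-cancelˡ-< 2 h (2 ^ K) y<) ⟩
  popcount x + popcount h          ≡⟨ cong (popcount x +_) (sym (popcount-2* h)) ⟩
  popcount x + popcount (2 * h)    ∎
  where
  open ≡-Reasoning
  shift-even : ∀ p x h → 2 * p * x + 2 * h ≡ 2 * (p * x + h)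
  shift-even = solve-∀
... | odd h = begin
  popcount (2 ^ suc K * x + (1 + 2 * h)) ≡⟨ cong popcount (shift-odd (2 ^ K) x h) ⟩
  popcount (1 + 2 * (2 ^ K * x + h))     ≡⟨ popcount-1+2* (2 ^ K * x + h) ⟩
  suc (popcount (2 ^ K * x + h))         ≡⟨ cong suc (popcount-2^*+ K x (*-cancelˡ-< 2 h (2 ^ K) (<-trans (n<1+n _) y<))) ⟩
  suc (popcount x + popcount h)          ≡⟨ sym (+-suc _ _) ⟩
  popcount x + suc (popcount h)          ≡⟨ cong (popcount x +_) (sym (popcount-1+2* h)) ⟩
  popcount x + popcount (1 + 2 * h)      ∎
  where
  open ≡-Reasoning
  shift-odd : ∀ p x h → 2 * p * x + (1 + 2 * h) ≡ 1 + 2 * (p * x + h)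
  shift-odd = solve-∀

popcount-2^* : ∀ K x → popcount (2 ^ K * x) ≡ popcount x
popcount-2^* K x = begin
  popcount (2 ^ K * x)     ≡⟨ cong popcount (sym (+-identityʳ (2 ^ K * x))) ⟩
  popcount (2 ^ K * x + 0) ≡⟨ popcount-2^*+ K x {0} (m^n>0 2 K) ⟩
  popcount x + 0           ≡⟨ +-identityʳ _ ⟩
  popcount x               ∎
  where open ≡-Reasoning

popcount-2^ : ∀ K → popcount (2 ^ K) ≡ 1
popcount-2^ K = trans (cong popcount (sym (*-identityʳ (2 ^ K)))) (popcount-2^* K 1)

allOnes : ℕ → ℕ
allOnes zero    = 0
allOnes (suc K) = 1 + 2 * allOnes K

1+allOnes : ∀ K → suc (allOnes K) ≡ 2 ^ K
1+allOnes zero    = refl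
1+allOnes (suc K) = trans (sym (*-suc 2 (allOnes K))) (cong (2 *_) (1+allOnes K))

allOnes<2^ : ∀ K → allOnes K < 2 ^ K
allOnes<2^ K = ≤-reflexive (1+allOnes K)

popcount-allOnes : ∀ K → popcount (allOnes K) ≡ K
popcount-allOnes zero    = refl
popcount-allOnes (suc K) = trans (popcount-1+2* (allOnes K)) (cong suc (popcount-allOnes K))

2-adic : ∀ n → Σ ℕ λ R → Σ ℕ λ u → suc n ≡ 2 ^ R * (1 + 2 * u)
2-adic = binary-induction (λ n → Σ ℕ λ R → Σ ℕ λ u → suc n ≡ 2 ^ R * (1 + 2 * u))
           (0 , 0 , refl) double double+1
  where
  double : ∀ h → (Σ ℕ λ R → Σ ℕ λ u → suc h ≡ 2 ^ R * (1 + 2 * u)) →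
           Σ ℕ λ R → Σ ℕ λ u → suc (2 * h) ≡ 2 ^ R * (1 + 2 * u)
  double h _ = 0 , h , sym (*-identityˡ _)
  double+1 : ∀ h → (Σ ℕ λ R → Σ ℕ λ u → suc h ≡ 2 ^ R * (1 + 2 * u)) →
             Σ ℕ λ R → Σ ℕ λ u → suc (1 + 2 * h) ≡ 2 ^ R * (1 + 2 * u)
  double+1 h (R , u , eq) = suc R , u , trans (sym (*-suc 2 h)) (trans (cong (2 *_) eq) (sym (*-assoc 2 (2 ^ R) _)))

module TwoAdic {a R u : ℕ} (a+1≡ : suc a ≡ 2 ^ R * (1 + 2 * u)) where

  popcount-a : popcount a ≡ popcount u + R
  popcount-a = begin
    popcount a                          ≡⟨ cong popcount a≡ ⟩
    popcount (2 ^ R * (2 * u) + allOnes R) ≡⟨ popcount-2^*+ R (2 * u) (allOnes<2^ R) ⟩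
    popcount (2 * u) + popcount (allOnes R) ≡⟨ cong₂ _+_ (popcount-2* u) (popcount-allOnes R) ⟩
    popcount u + R                      ∎
    where
    open ≡-Reasoning
    a≡ : a ≡ 2 ^ R * (2 * u) + allOnes R
    a≡ = suc-injective (begin
      suc a                                    ≡⟨ a+1≡ ⟩
      2 ^ R * (1 + 2 * u)                      ≡⟨ cong (_* (1 + 2 * u)) (sym (1+allOnes R)) ⟩
      suc (allOnes R) * (1 + 2 * u)            ≡⟨ split (allOnes R) u ⟩
      suc (suc (allOnes R) * (2 * u) + allOnes R) ≡⟨ cong (λ p → suc (p * (2 * u) + allOnes R)) (1+allOnes R) ⟩
      suc (2 ^ R * (2 * u) + allOnes R)        ∎)
      where
      split : ∀ o u → suc o * (1 + 2 * u) ≡ suc (suc o * (2 * u) + o)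
      split = solve-∀

  popcount-a+2^ : ∀ {i} → i ≤ R → popcount (a + 2 ^ i) ≡ suc (popcount u + i)
  popcount-a+2^ {i} i≤R = begin
    popcount (a + 2 ^ i)                          ≡⟨ cong popcount a+2^i≡ ⟩
    popcount (2 ^ R * (1 + 2 * u) + allOnes i)   ≡⟨ popcount-2^*+ R (1 + 2 * u) allOnes<2^R ⟩
    popcount (1 + 2 * u) + popcount (allOnes i)   ≡⟨ cong₂ _+_ (popcount-1+2* u) (popcount-allOnes i) ⟩
    suc (popcount u + i)                          ∎
    where
    open ≡-Reasoning
    allOnes<2^R : allOnes i < 2 ^ R
    allOnes<2^R = <-≤-trans (allOnes<2^ i) (^-monoʳ-≤ 2 i≤R)
    a+2^i≡ : a + 2 ^ i ≡ 2 ^ R * (1 + 2 * u) + allOnes i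
    a+2^i≡ = trans (cong (a +_) (sym (1+allOnes i))) (trans (+-suc a (allOnes i)) (cong (_+ allOnes i) a+1≡))

-- Sums of powers of two

infixr 5 _∷_
data PowSum : ℕ → ℕ → Set where
  []  : PowSum 0 0
  _∷_ : ∀ i {b j} → PowSum b j → PowSum (2 ^ i + b) (suc j)

PowSum-cast : ∀ {b b′ j} → b ≡ b′ → PowSum b j → PowSum b′ j
PowSum-cast refl s = s

PowSum-length≤ : ∀ {b j} → PowSum b j → j ≤ b
PowSum-length≤ []      = z≤n
PowSum-length≤ (i ∷ s) = +-mono-≤ (m^n>0 2 i) (PowSum-length≤ s)

PowSum-empty : ∀ {b} → PowSum b 0 → b ≡ 0
PowSum-empty [] = refl

PowSum-++ : ∀ {a k b l} → PowSum a k → PowSum b l → PowSum (a + b) (k + l)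
PowSum-++                []            t = t
PowSum-++ {b = b} (_∷_ i {a} s) t = PowSum-cast (sym (+-assoc (2 ^ i) a b)) (i ∷ PowSum-++ s t)

PowSum-2* : ∀ {b j} → PowSum b j → PowSum (2 * b) j
PowSum-2* []            = []
PowSum-2* (_∷_ i {b} s) = PowSum-cast (sym (*-distribˡ-+ 2 (2 ^ i) b)) (suc i ∷ PowSum-2* s)

PowSum-ones : ∀ d → PowSum d d
PowSum-ones zero    = []
PowSum-ones (suc d) = 0 ∷ PowSum-ones d

PowSum-split : ∀ {b j} → PowSum b j → j < b → PowSum b (suc j)
PowSum-split (zero ∷ s)          (s≤s j<b) = 0 ∷ PowSum-split s j<b
PowSum-split (_∷_ (suc i) {b} s) _         = PowSum-cast (halves (2 ^ i) b) (i ∷ (i ∷ s))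
  where
  halves : ∀ p b → p + (p + b) ≡ 2 * p + b
  halves = solve-∀

PowSum-lengthen : ∀ {b j} d → PowSum b j → j + d ≤ b → PowSum b (j + d)
PowSum-lengthen {b} {j} zero    s _     = subst (PowSum b) (sym (+-identityʳ j)) s
PowSum-lengthen {b} {j} (suc d) s j+d<b =
  subst (PowSum b) (sym (+-suc j d)) (PowSum-split (PowSum-lengthen d s (<⇒≤ j+d<b′)) j+d<b′)
  where
  j+d<b′ : j + d < b
  j+d<b′ = subst (_≤ b) (+-suc j d) j+d<b

popcount-2^+≤ : ∀ i n → popcount (2 ^ i + n) ≤ suc (popcount n)
popcount-2^+≤ zero    n = popcount-suc≤ n
popcount-2^+≤ (suc i) n with evenOdd n
... | even h = begin
  popcount (2 ^ suc i + 2 * h) ≡⟨ cong popcount (sym (*-distribˡ-+ 2 (2 ^ i) h)) ⟩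
  popcount (2 * (2 ^ i + h))   ≡⟨ popcount-2* (2 ^ i + h) ⟩
  popcount (2 ^ i + h)         ≤⟨ popcount-2^+≤ i h ⟩
  suc (popcount h)             ≡⟨ cong suc (sym (popcount-2* h)) ⟩
  suc (popcount (2 * h))       ∎
  where open ≤-Reasoning
... | odd h = begin
  popcount (2 ^ suc i + (1 + 2 * h)) ≡⟨ cong popcount (carry (2 ^ i) h) ⟩
  popcount (1 + 2 * (2 ^ i + h))     ≡⟨ popcount-1+2* (2 ^ i + h) ⟩
  suc (popcount (2 ^ i + h))         ≤⟨ s≤s (popcount-2^+≤ i h) ⟩
  suc (suc (popcount h))             ≡⟨ cong suc (sym (popcount-1+2* h)) ⟩
  suc (popcount (1 + 2 * h))         ∎
  where
  open ≤-Reasoning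
  carry : ∀ p h → 2 * p + (1 + 2 * h) ≡ 1 + 2 * (p + h)
  carry = solve-∀

popcount≤length : ∀ {b j} → PowSum b j → popcount b ≤ j
popcount≤length []      = z≤n
popcount≤length (_∷_ i {b} s) = ≤-trans (popcount-2^+≤ i b) (s≤s (popcount≤length s))

PowSum-popcount : ∀ b → PowSum b (popcount b)
PowSum-popcount = binary-induction (λ b → PowSum b (popcount b)) [] double double+1
  where
  double : ∀ h → PowSum h (popcount h) → PowSum (2 * h) (popcount (2 * h))
  double h s = subst (PowSum _) (sym (popcount-2* h)) (PowSum-2* s)
  double+1 : ∀ h → PowSum h (popcount h) → PowSum (1 + 2 * h) (popcount (1 + 2 * h))
  double+1 h s = subst (PowSum _) (sym (popcount-1+2* h)) (0 ∷ PowSum-2* s)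

PowSum-between : ∀ {b j} → popcount b ≤ j → j ≤ b → PowSum b j
PowSum-between {b} {j} pc≤j j≤b with m≤n⇒∃[o]m+o≡n pc≤j
... | d , refl = PowSum-lengthen d (PowSum-popcount b) j≤b

popcount-+ : ∀ a b → popcount (a + b) ≤ popcount a + popcount b
popcount-+ a b = popcount≤length (PowSum-++ (PowSum-popcount a) (PowSum-popcount b))

popcount≤n : ∀ n → popcount n ≤ n
popcount≤n n = PowSum-length≤ (PowSum-popcount n)

2^-cancel-≤ : ∀ {i j} → 2 ^ i ≤ 2 ^ j → i ≤ j
2^-cancel-≤ {i} {j} 2^i≤2^j with i ≤? j
... | yes i≤j = i≤j
... | no  i≰j = ⊥-elim (<⇒≱ (^-monoʳ-< 2 (s≤s (s≤s z≤n)) (≰⇒> i≰j)) 2^i≤2^j)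

2^-cancel-< : ∀ {i j} → 2 ^ i < 2 ^ j → i < j
2^-cancel-< {i} {j} 2^i<2^j with i <? j
... | yes i<j = i<j
... | no  i≮j = ⊥-elim (<⇒≱ 2^i<2^j (^-monoʳ-≤ 2 (≮⇒≥ i≮j)))

2^≡2*2^pred : ∀ {r} → 1 ≤ r → 2 ^ r ≡ 2 * 2 ^ pred r
2^≡2*2^pred (s≤s z≤n) = refl

n<2^n : ∀ n → n < 2 ^ n
n<2^n zero    = s≤s z≤n
n<2^n (suc n) = +-mono-≤ (m^n>0 2 n) (≤-trans (n<2^n n) (m≤m+n (2 ^ n) 0))

2*n+2≤2^n : ∀ n → 3 ≤ n → 2 * n + 2 ≤ 2 ^ n
2*n+2≤2^n 0 ()
2*n+2≤2^n 1 (s≤s ())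
2*n+2≤2^n 2 (s≤s (s≤s ()))
2*n+2≤2^n 3 _ = ≤-refl
2*n+2≤2^n (suc (suc (suc (suc n)))) _ = begin
  2 * (4 + n) + 2             ≡⟨ regroup n ⟩
  (2 * (3 + n) + 2) + 2       ≤⟨ +-mono-≤ (2*n+2≤2^n (suc (suc (suc n))) (s≤s (s≤s (s≤s z≤n)))) (^-monoʳ-≤ 2 {1} {3 + n} (s≤s z≤n)) ⟩
  2 ^ (3 + n) + 2 ^ (3 + n)   ≡⟨ cong (2 ^ (3 + n) +_) (sym (+-identityʳ _)) ⟩
  2 ^ (4 + n)                 ∎
  where
  open ≤-Reasoning
  regroup : ∀ n → 2 * (4 + n) + 2 ≡ (2 * (3 + n) + 2) + 2
  regroup = solve-∀

n+3≤2^n : ∀ {n} → 3 ≤ n → n + 3 ≤ 2 ^ n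
n+3≤2^n {n} 3≤n = begin
  n + 3         ≡⟨ +-assoc n 2 1 ⟨
  n + 2 + 1     ≤⟨ +-monoʳ-≤ (n + 2) (≤-trans (s≤s z≤n) 3≤n) ⟩
  n + 2 + n     ≡⟨ regroup n ⟩
  2 * n + 2     ≤⟨ 2*n+2≤2^n n 3≤n ⟩
  2 ^ n         ∎
  where
  open ≤-Reasoning
  regroup : ∀ n → n + 2 + n ≡ 2 * n + 2
  regroup = solve-∀

4≤⇒2+log≤ : ∀ {c} i → 4 ≤ c → 2 ^ i ≤ suc c → 2 + i ≤ c
4≤⇒2+log≤ 0 4≤c _ = ≤-trans (s≤s (s≤s z≤n)) 4≤c
4≤⇒2+log≤ 1 4≤c _ = ≤-trans (s≤s (s≤s (s≤s z≤n))) 4≤c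
4≤⇒2+log≤ 2 4≤c _ = 4≤c
4≤⇒2+log≤ i@(suc (suc (suc _))) _ 2^i≤1+c =
  s≤s⁻¹ (≤-trans (≤-reflexive (+-comm 3 i)) (≤-trans (n+3≤2^n {i} (s≤s (s≤s (s≤s z≤n)))) 2^i≤1+c))

2+log≤⇒4≤ : ∀ {c} → (∀ i → 2 ^ i ≤ suc c → 2 + i ≤ c) → 4 ≤ c
2+log≤⇒4≤ {0} bound with bound 0 ≤-refl
... | ()
2+log≤⇒4≤ {1} bound with bound 1 ≤-refl
... | s≤s ()
2+log≤⇒4≤ {2} bound with bound 1 (s≤s (s≤s z≤n))
... | s≤s (s≤s ())
2+log≤⇒4≤ {3} bound with bound 2 ≤-refl
... | s≤s (s≤s (s≤s ()))
2+log≤⇒4≤ {suc (suc (suc (suc c)))} _ = s≤s (s≤s (s≤s (s≤s z≤n)))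

2^n≤2+n⇒n≤2 : ∀ {n} → 2 ^ n ≤ 2 + n → n ≤ 2
2^n≤2+n⇒n≤2 {n} 2^n≤ with n ≤? 2
... | yes n≤2 = n≤2
... | no  n≰2 = ⊥-elim (<⇒≱ (≤-trans (≤-reflexive (+-comm 3 n)) (n+3≤2^n (≰⇒> n≰2))) 2^n≤)

excess-window : ∀ R δ → 2 ^ R + δ ≤ 2 + R → (∀ i → 2 ^ i ≤ suc δ → 3 + i ≤ 2 ^ R + δ) → R ≡ 2 × δ ≡ 0
excess-window 0 δ le window with ≤-trans (window 0 (s≤s z≤n)) le
... | s≤s (s≤s ())
excess-window 1 0 _ window with window 0 (s≤s z≤n)
... | s≤s (s≤s ())
excess-window 1 1 _ window with window 1 ≤-refl
... | s≤s (s≤s (s≤s ()))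
excess-window 1 (suc (suc δ)) (s≤s (s≤s (s≤s ()))) _
excess-window 2 0 _ _ = refl , refl
excess-window 2 (suc δ) (s≤s (s≤s (s≤s (s≤s ())))) _
excess-window R@(suc (suc (suc _))) δ le _ with 2^n≤2+n⇒n≤2 (≤-trans (m≤m+n (2 ^ R) δ) le)
... | s≤s (s≤s ())

odd≢even : ∀ u v → 1 + 2 * u ≢ 2 * v
odd≢even u v eq = 1+n≢0 (trans (sym (bit-1+2* u)) (trans (cong bit eq) (bit-2* v)))

odd-split : ∀ {u X v} → 1 + 2 * u ≡ 2 * X + v → Σ ℕ λ y → v ≡ 1 + 2 * y × u ≡ X + y
odd-split {u} {X} {v} eq with evenOdd v
... | even y = ⊥-elim (odd≢even u (X + y) (trans eq (sym (*-distribˡ-+ 2 X y))))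
... | odd y  = y , refl , *-cancelˡ-≡ u (X + y) 2 (suc-injective (trans eq (regroup X y)))
  where
  regroup : ∀ X y → 2 * X + (1 + 2 * y) ≡ suc (2 * (X + y))
  regroup = solve-∀

odd-factor-trivial : ∀ {R y δ} → 1 ≤ R → 2 ^ R * (1 + 2 * y) + δ ≤ 2 + y + R → y ≡ 0
odd-factor-trivial {y = zero} _ _ = refl
odd-factor-trivial {R} {suc y} {δ} 1≤R le = ⊥-elim (<⇒≱ too-big (≤-trans (m≤m+n _ δ) le))
  where
  regroup : ∀ R y → 4 + y + R + (1 + 3 * y) ≡ suc R + 4 * suc y
  regroup = solve-∀
  too-big : 2 + suc y + R < 2 ^ R * (1 + 2 * suc y)
  too-big = begin-strict
    2 + suc y + R                  <⟨ ≤-trans (m≤m+n (4 + y + R) (1 + 3 * y)) (≤-reflexive (regroup R y)) ⟩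
    suc R + 4 * suc y              ≡⟨ cong (suc R +_) (*-assoc 2 2 (suc y)) ⟩
    suc R + 2 * (2 * suc y)        ≤⟨ +-mono-≤ (n<2^n R) (*-monoˡ-≤ (2 * suc y) (^-monoʳ-≤ 2 1≤R)) ⟩
    2 ^ R + 2 ^ R * (2 * suc y)    ≡⟨ cong (_+ 2 ^ R * (2 * suc y)) (sym (*-identityʳ (2 ^ R))) ⟩
    2 ^ R * 1 + 2 ^ R * (2 * suc y) ≡⟨ *-distribˡ-+ (2 ^ R) 1 (2 * suc y) ⟨
    2 ^ R * (1 + 2 * suc y)        ∎
    where open ≤-Reasoning

∸-1-suc : ∀ {L d N} → suc (suc L) + d ≡ N → N ∸ 1 ∸ suc d ≡ L
∸-1-suc {L} {d} refl = m+n∸n≡m L d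

+[∸-1-suc] : ∀ {d N} → suc (suc d) ≤ N → suc (suc d) + (N ∸ 1 ∸ suc d) ≡ N
+[∸-1-suc] {d} {N} 2+d≤N = trans (cong (suc (suc d) +_) (∸-+-assoc N 1 (suc d))) (m+[n∸m]≡n 2+d≤N)

-- Coordinates in the semigroup

rem-≥ : ∀ d {q ρ q′ ρ′} → d * q + ρ ≡ d * q′ + ρ′ → q < q′ → d + ρ′ ≤ ρ
rem-≥ d {q} {ρ} {q′} {ρ′} eq q<q′ with m≤n⇒∃[o]m+o≡n q<q′
... | f , refl =
  subst (d + ρ′ ≤_) (sym (+-cancelˡ-≡ (d * q) ρ _ (trans eq (regroup d q f ρ′)))) (m≤m+n (d + ρ′) (d * f))
  where
  regroup : ∀ d q f ρ′ → d * (suc q + f) + ρ′ ≡ d * q + (d + ρ′ + d * f)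
  regroup = solve-∀

divMod-unique : ∀ d {q ρ q′ ρ′} → d * q + ρ ≡ d * q′ + ρ′ → ρ < d → ρ′ < d → q ≡ q′ × ρ ≡ ρ′
divMod-unique d {q} {ρ} {q′} {ρ′} eq ρ<d ρ′<d with <-cmp q q′
... | tri< q<q′ _ _ = ⊥-elim (<⇒≱ ρ<d (≤-trans (m≤m+n d ρ′) (rem-≥ d eq q<q′)))
... | tri≈ _ refl _ = refl , +-cancelˡ-≡ (d * q) ρ ρ′ eq
... | tri> _ _ q′<q = ⊥-elim (<⇒≱ ρ′<d (≤-trans (m≤m+n d ρ) (rem-≥ d (sym eq) q′<q)))

divMod-≡ : ∀ x d .{{_ : NonZero d}} → x ≡ d * (x / d) + x % d
divMod-≡ x d = trans (m≡m%n+[m/n]*n x d) (trans (+-comm (x % d) _) (cong (_+ x % d) (*-comm (x / d) d)))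

-- x = M b + j with b a sum of j powers of two: exactly the sums of j generators M 2^i + 1.
InS : ℕ → ℕ → Set
InS M x = Σ ℕ λ b → Σ ℕ λ j → x ≡ M * b + j × PowSum b j

InS-+ : ∀ {M x y} → InS M x → InS M y → InS M (x + y)
InS-+ {M} (b , j , refl , s) (b′ , j′ , refl , s′) = b + b′ , j + j′ , regroup M b j b′ j′ , PowSum-++ s s′
  where
  regroup : ∀ M b j b′ j′ → M * b + j + (M * b′ + j′) ≡ M * (b + b′) + (j + j′)
  regroup = solve-∀

InS-coords-unique : ∀ M {b j B J} → PowSum b j → M * b + j ≡ M * B + J → J ≤ M → B ≤ J + M →
                    b ≡ B × j ≡ J
InS-coords-unique M {b} {j} {B} {J} s eq J≤M B≤J+M with <-cmp b B
... | tri< b<B _ _ = ⊥-elim (<⇒≱ (≤-<-trans (PowSum-length≤ s) b<B)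
                       (≤-trans B≤J+M (≤-trans (≤-reflexive (+-comm J M)) (rem-≥ M eq b<B))))
... | tri≈ _ refl _ = refl , +-cancelˡ-≡ (M * b) j J eq
... | tri> _ _ B<b = ⊥-elim (n≮0 (subst (B <_) (PowSum-empty (subst (PowSum b) j≡0 s)) B<b))
  where
  j≡0 : j ≡ 0
  j≡0 = n≤0⇒n≡0 (+-cancelˡ-≤ M j 0 (≤-trans (rem-≥ M (sym eq) B<b) (≤-trans J≤M (≤-reflexive (sym (+-identityʳ M))))))

module Generators (m n : ℕ) where

  M : ℕ
  M = m * 2 ^ n

  gen≡ : ∀ i → gen m n i ≡ M * 2 ^ i + 1
  gen≡ i = cong (_+ 1) (trans (cong (m *_) (^-distribˡ-+-* 2 n i)) (sym (*-assoc m (2 ^ n) (2 ^ i))))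

  InP→InS : ∀ {x} → InP m n x → InS M x
  InP→InS none = 0 , 0 , sym (trans (+-identityʳ _) (*-zeroʳ M)) , []
  InP→InS (add i p) with InP→InS p
  ... | b , j , refl , s = 2 ^ i + b , suc j , trans (cong (_+ (M * b + j)) (gen≡ i)) (regroup M (2 ^ i) b j) , i ∷ s
    where
    regroup : ∀ M p b j → M * p + 1 + (M * b + j) ≡ M * (p + b) + suc j
    regroup = solve-∀

  PowSum→InP : ∀ {b j} → PowSum b j → InP m n (M * b + j)
  PowSum→InP [] = subst (InP m n) (sym (trans (+-identityʳ _) (*-zeroʳ M))) none
  PowSum→InP (_∷_ i {b} {j} s) =
    subst (InP m n) (trans (cong (_+ (M * b + j)) (gen≡ i)) (regroup M (2 ^ i) b j)) (add i (PowSum→InP s))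
    where
    regroup : ∀ M p b j → M * p + 1 + (M * b + j) ≡ M * (p + b) + suc j
    regroup = solve-∀

  InS→InP : ∀ {x} → InS M x → InP m n x
  InS→InP (b , j , refl , s) = PowSum→InP s

  sumGen≡ : ∀ b len → sumGen m n b len + M * 2 ^ b ≡ M * 2 ^ (b + len) + len
  sumGen≡ b zero    = trans (cong (λ t → M * 2 ^ t) (sym (+-identityʳ b))) (sym (+-identityʳ _))
  sumGen≡ b (suc len) = begin
    gen m n b + sumGen m n (suc b) len + M * 2 ^ b       ≡⟨ cong (λ t → t + sumGen m n (suc b) len + M * 2 ^ b) (gen≡ b) ⟩
    M * 2 ^ b + 1 + sumGen m n (suc b) len + M * 2 ^ b   ≡⟨ regroup M (2 ^ b) (sumGen m n (suc b) len) ⟩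
    sumGen m n (suc b) len + M * 2 ^ suc b + 1           ≡⟨ cong (_+ 1) (sumGen≡ (suc b) len) ⟩
    M * 2 ^ (suc b + len) + len + 1                      ≡⟨ cong (λ t → M * 2 ^ t + len + 1) (sym (+-suc b len)) ⟩
    M * 2 ^ (b + suc len) + len + 1                      ≡⟨ trans (+-assoc _ len 1) (cong (M * 2 ^ (b + suc len) +_) (+-comm len 1)) ⟩
    M * 2 ^ (b + suc len) + suc len                      ∎
    where
    open ≡-Reasoning
    regroup : ∀ M p S → M * p + 1 + S + M * p ≡ S + M * (2 * p) + 1
    regroup = solve-∀

  2gen+sumGen≡ : ∀ i L → 2 * gen m n i + sumGen m n (suc i) L ≡ M * 2 ^ (suc i + L) + (2 + L)
  2gen+sumGen≡ i L = begin
    2 * gen m n i + sumGen m n (suc i) L           ≡⟨ cong (λ t → 2 * t + sumGen m n (suc i) L) (gen≡ i) ⟩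
    2 * (M * 2 ^ i + 1) + sumGen m n (suc i) L     ≡⟨ regroup M (2 ^ i) (sumGen m n (suc i) L) ⟩
    sumGen m n (suc i) L + M * 2 ^ suc i + 2       ≡⟨ cong (_+ 2) (sumGen≡ (suc i) L) ⟩
    M * 2 ^ (suc i + L) + L + 2                    ≡⟨ trans (+-assoc _ L 2) (cong (M * 2 ^ (suc i + L) +_) (+-comm L 2)) ⟩
    M * 2 ^ (suc i + L) + (2 + L)                  ∎
    where
    open ≡-Reasoning
    regroup : ∀ M p S → 2 * (M * p + 1) + S ≡ S + M * (2 * p) + 2
    regroup = solve-∀

IsPFℕ : ℕ → ℕ → Set
IsPFℕ M x = ¬ InS M x × (∀ i → InS M (x + (M * 2 ^ i + 1)))

module _ where
  open import Data.Integer using (+_)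

  ℤ-+-cancelʳ : ∀ {x y} s → x ℤ.+ s ≡ y ℤ.+ s → x ≡ y
  ℤ-+-cancelʳ {x} {y} s eq = trans (add-sub x s) (trans (cong (ℤ._- s) eq) (sym (add-sub y s)))
    where
    add-sub : ∀ x s → x ≡ x ℤ.+ s ℤ.- s
    add-sub = ℤ-Solver.solve-∀

  +-shift : ∀ {z} x s → z ℤ.+ + s ≡ + (x + s) → z ≡ + x
  +-shift x s eq = ℤ-+-cancelʳ (+ s) (trans eq (ℤP.pos-+ x s))

  ≡+⇔≡-+ : ∀ {z x s V} → x + s ≡ V → (z ≡ + x) ⇔ (z ≡ + V ℤ.- + s)
  ≡+⇔≡-+ {z} {x} {s} refl = mk⇔ (λ z≡x → trans z≡x (sym (x≡x+s-s x s)))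
                                 (λ z≡ → trans z≡ (x≡x+s-s x s))
    where
    x≡x+s-s : ∀ x s → + (x + s) ℤ.- + s ≡ + x
    x≡x+s-s x s = trans (cong (ℤ._- + s) (ℤP.pos-+ x s)) (sub-add (+ x) (+ s))
      where
      sub-add : ∀ x s → x ℤ.+ s ℤ.- s ≡ x
      sub-add = ℤ-Solver.solve-∀

  module PseudoFrobenius (m n : ℕ) (0<m : 0 < m) where
    open Generators m n

    0<M : 0 < M
    0<M = *-mono-< {0} {m} {0} {2 ^ n} 0<m (m^n>0 2 n)

    gen∈ : ∀ i → InP m n (gen m n i)
    gen∈ i = subst (InP m n) (+-identityʳ _) (add i none)

    gen≢0 : ∀ i → ¬ gen m n i ≡ 0
    gen≢0 i eq = 1+n≢0 (trans (+-comm 1 _) eq)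

    M∉S : ¬ InS M M
    M∉S (b , j , eq , s) with InS-coords-unique M s (trans (sym eq) (sym (trans (+-identityʳ _) (*-identityʳ M)))) z≤n 0<M
    ... | refl , refl = 1+n≢0 (PowSum-empty s)

    gen1≡ : gen m n 1 ≡ M + gen m n 0
    gen1≡ = trans (gen≡ 1) (trans (twice M) (cong (λ t → M + t) (sym (gen≡ 0))))
      where
      twice : ∀ M → M * 2 + 1 ≡ M + (M * 1 + 1)
      twice = solve-∀

    -- Otherwise z + s₁ = M, which is not in S.
    z+s₀≢0 : ∀ {z} → IsPF m n z → ¬ z ℤ.+ + gen m n 0 ≡ + 0
    z+s₀≢0 {z} (_ , closed) z+s₀≡0 with closed (gen m n 1) (gen∈ 1) (gen≢0 1)
    ... | y , z+s₁≡y , y∈S = M∉S (subst (InS M) y≡M (InP→InS y∈S))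
      where
      y≡M : y ≡ M
      y≡M = ℤP.+-injective (begin
        + y                             ≡⟨ sym z+s₁≡y ⟩
        z ℤ.+ + gen m n 1               ≡⟨ cong (λ t → z ℤ.+ + t) gen1≡ ⟩
        z ℤ.+ + (M + gen m n 0)         ≡⟨ cong (ℤ._+_ z) (ℤP.pos-+ M (gen m n 0)) ⟩
        z ℤ.+ (+ M ℤ.+ + gen m n 0)     ≡⟨ swap z (+ M) (+ gen m n 0) ⟩
        + M ℤ.+ (z ℤ.+ + gen m n 0)     ≡⟨ cong (ℤ._+_ (+ M)) z+s₀≡0 ⟩
        + M ℤ.+ + 0                     ≡⟨ ℤP.+-identityʳ (+ M) ⟩
        + M                             ∎)
        where
        open ≡-Reasoning
        swap : ∀ x y z → x ℤ.+ (y ℤ.+ z) ≡ y ℤ.+ (x ℤ.+ z)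
        swap = ℤ-Solver.solve-∀

    IsPF⇒IsPFℕ : ∀ z → IsPF m n z → Σ ℕ λ x → z ≡ + x × IsPFℕ M x
    IsPF⇒IsPFℕ z (z∉S , closed) with closed (gen m n 0) (gen∈ 0) (gen≢0 0)
    ... | w , z+s₀≡w , w∈S with InP→InS w∈S
    ... | zero , j , refl , s with n≤0⇒n≡0 (PowSum-length≤ s)
    ...   | refl = ⊥-elim (z+s₀≢0 (z∉S , closed) (trans z+s₀≡w (cong +_ (trans (+-identityʳ _) (*-zeroʳ M)))))
    IsPF⇒IsPFℕ z (z∉S , closed) | w , z+s₀≡w , w∈S | suc b , zero , refl , s = ⊥-elim (1+n≢0 (PowSum-empty s))
    IsPF⇒IsPFℕ z (z∉S , closed) | w , z+s₀≡w , w∈S | suc b , suc j , refl , s =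
      x , z≡x , (λ x∈S → z∉S (x , z≡x , InS→InP x∈S)) , shifted∈S
      where
      x : ℕ
      x = M * b + j
      w≡x+s₀ : M * suc b + suc j ≡ x + gen m n 0
      w≡x+s₀ = trans (regroup M b j) (cong (λ t → x + t) (sym (gen≡ 0)))
        where
        regroup : ∀ M b j → M * suc b + suc j ≡ M * b + j + (M * 1 + 1)
        regroup = solve-∀
      z≡x : z ≡ + x
      z≡x = +-shift x (gen m n 0) (trans z+s₀≡w (cong +_ w≡x+s₀))
      shifted∈S : ∀ i → InS M (x + (M * 2 ^ i + 1))
      shifted∈S i with closed (gen m n i) (gen∈ i) (gen≢0 i)
      ... | y , z+sᵢ≡y , y∈S = subst (InS M) y≡ (InP→InS y∈S)
        where
        y≡ : y ≡ x + (M * 2 ^ i + 1)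
        y≡ = ℤP.+-injective (trans (sym z+sᵢ≡y) (trans (cong (ℤ._+ + gen m n i) z≡x)
               (trans (sym (ℤP.pos-+ x (gen m n i))) (cong (λ t → + (x + t)) (gen≡ i)))))

    IsPFℕ⇒IsPF : ∀ {z} x → z ≡ + x → IsPFℕ M x → IsPF m n z
    IsPFℕ⇒IsPF {z} x z≡x (x∉S , shifted∈S) = z∉S , closed
      where
      z∉S : ¬ InPℤ m n z
      z∉S (y , z≡y , y∈S) = x∉S (subst (InS M) (ℤP.+-injective (trans (sym z≡y) z≡x)) (InP→InS y∈S))
      closed : ∀ y → InP m n y → ¬ y ≡ 0 → InPℤ m n (z ℤ.+ + y)
      closed .0 none y≢0 = ⊥-elim (y≢0 refl)
      closed .(gen m n i + y) (add i {y} y∈S) _ =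
        x + gen m n i + y , sum≡ ,
        InS→InP (InS-+ {M} (subst (λ t → InS M (x + t)) (sym (gen≡ i)) (shifted∈S i)) (InP→InS y∈S))
        where
        sum≡ : z ℤ.+ + (gen m n i + y) ≡ + (x + gen m n i + y)
        sum≡ = trans (cong (ℤ._+ + (gen m n i + y)) z≡x)
                 (trans (sym (ℤP.pos-+ x (gen m n i + y))) (cong +_ (sym (+-assoc x (gen m n i) y))))

    IsPF⇔IsPFℕ : ∀ z → IsPF m n z ⇔ (Σ ℕ λ x → z ≡ + x × IsPFℕ M x)
    IsPF⇔IsPFℕ z = mk⇔ (IsPF⇒IsPFℕ z) (λ (x , z≡x , pf) → IsPFℕ⇒IsPF x z≡x pf)

-- The pseudo-Frobenius conditions on x = M a + k (k < M) in coordinates; outside the window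
-- a + 2ⁱ ≤ k + 1 + M, the element x + sᵢ always lies in S.
PFCriterion : ℕ → ℕ → ℕ → Set
PFCriterion M a k = a ≤ k + M × k < popcount a ×
                    (∀ i → a + 2 ^ i ≤ suc k + M → popcount (a + 2 ^ i) ≤ suc k)

-- The criterion in terms of a + 1 = 2^R (1 + 2u), where popcount a = popcount u + R and
-- popcount (a + 2ⁱ) = popcount u + i + 1 for i ≤ R.
record Profile (M a k : ℕ) : Set where
  field
    R u δ  : ℕ
    a+1≡   : suc a ≡ 2 ^ R * (1 + 2 * u)
    a+1+δ≡ : suc a + δ ≡ suc k + M
    δ<2^R  : δ < 2 ^ R
    gap    : suc k ≤ popcount u + R
    window : ∀ i → 2 ^ i ≤ suc δ → suc (popcount u + i) ≤ suc k

PFCriterion⇒Profile : ∀ {M a k} → PFCriterion M a k → Profile M a k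
PFCriterion⇒Profile {M} {a} {k} (a≤k+M , k<popcount , window-∈S) = record
  { R = R ; u = u ; δ = δ ; a+1≡ = a+1≡ ; a+1+δ≡ = a+1+δ≡ ; δ<2^R = δ<2^R
  ; gap = subst (suc k ≤_) popcount-a k<popcount
  ; window = window
  }
  where
  R u δ : ℕ
  R = proj₁ (2-adic a)
  u = proj₁ (proj₂ (2-adic a))
  a+1≡ : suc a ≡ 2 ^ R * (1 + 2 * u)
  a+1≡ = proj₂ (proj₂ (2-adic a))
  open TwoAdic {a} {R} {u} a+1≡
  δ = proj₁ (m≤n⇒∃[o]m+o≡n (s≤s a≤k+M))
  a+1+δ≡ : suc a + δ ≡ suc k + M
  a+1+δ≡ = proj₂ (m≤n⇒∃[o]m+o≡n (s≤s a≤k+M))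
  window-exceeded : suc k + M < a + 2 ^ R
  window-exceeded with a + 2 ^ R ≤? suc k + M
  ... | no  out = ≰⇒> out
  ... | yes in′ = ⊥-elim (<⇒≱ k<popcount (≤-pred (begin
    suc (popcount a)     ≡⟨ cong suc popcount-a ⟩
    suc (popcount u + R) ≡⟨ sym (popcount-a+2^ ≤-refl) ⟩
    popcount (a + 2 ^ R) ≤⟨ window-∈S R in′ ⟩
    suc k                ∎)))
    where open ≤-Reasoning
  δ<2^R : δ < 2 ^ R
  δ<2^R = <⇒≤ (+-cancelˡ-< a (suc δ) (2 ^ R) (≤-<-trans (≤-reflexive (trans (+-suc a δ) a+1+δ≡)) window-exceeded))
  window : ∀ i → 2 ^ i ≤ suc δ → suc (popcount u + i) ≤ suc k
  window i 2^i≤ = begin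
    suc (popcount u + i) ≡⟨ sym (popcount-a+2^ (2^-cancel-≤ (≤-trans 2^i≤ δ<2^R))) ⟩
    popcount (a + 2 ^ i) ≤⟨ window-∈S i (≤-trans (+-monoʳ-≤ a 2^i≤) (≤-reflexive (trans (+-suc a δ) a+1+δ≡))) ⟩
    suc k                ∎
    where open ≤-Reasoning

Profile⇒PFCriterion : ∀ {M a k} → Profile M a k → PFCriterion M a k
Profile⇒PFCriterion {M} {a} {k} p = a≤k+M , subst (suc k ≤_) (sym popcount-a) gap , window-∈S
  where
  open Profile p
  open TwoAdic {a} {R} {u} a+1≡
  a≤k+M : a ≤ k + M
  a≤k+M = ≤-pred (≤-trans (m≤m+n (suc a) δ) (≤-reflexive a+1+δ≡))
  window-∈S : ∀ i → a + 2 ^ i ≤ suc k + M → popcount (a + 2 ^ i) ≤ suc k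
  window-∈S i a+2^i≤ = ≤-trans (≤-reflexive (popcount-a+2^ (2^-cancel-≤ (≤-trans 2^i≤ δ<2^R)))) (window i 2^i≤)
    where
    2^i≤ : 2 ^ i ≤ suc δ
    2^i≤ = +-cancelˡ-≤ a (2 ^ i) (suc δ) (≤-trans a+2^i≤ (≤-reflexive (trans (sym a+1+δ≡) (sym (+-suc a δ)))))

-- The semigroup P_{2^r+1}(n)

module Classification (n r : ℕ) (2<n : 2 < n) (1≤r : 1 ≤ r) (2^r+1<2^n : 2 ^ r + 1 < 2 ^ n) where
  open Generators (2 ^ r + 1) n

  P Q N T : ℕ
  P = 2 ^ n
  Q = 2 ^ r
  N = n + r
  T = 2 ^ suc N

  2^N≡P*Q : 2 ^ N ≡ P * Q
  2^N≡P*Q = ^-distribˡ-+-* 2 n r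

  M≡2^N+P : M ≡ 2 ^ N + P
  M≡2^N+P = trans (*-distribʳ-+ P Q 1) (cong₂ _+_ (trans (*-comm Q P) (sym 2^N≡P*Q)) (*-identityˡ P))

  r<n : r < n
  r<n with r <? n
  ... | yes r<n = r<n
  ... | no  r≮n = ⊥-elim (<⇒≱ 2^r+1<2^n (≤-trans (^-monoʳ-≤ 2 (≮⇒≥ r≮n)) (m≤m+n Q 1)))

  2+N<P : 2 + N < P
  2+N<P = begin-strict
    2 + (n + r)   <⟨ +-monoʳ-< 2 (+-monoʳ-< n r<n) ⟩
    2 + (n + n)   ≡⟨ regroup n ⟩
    2 * n + 2     ≤⟨ 2*n+2≤2^n n 2<n ⟩
    P             ∎
    where
    open ≤-Reasoning
    regroup : ∀ n → 2 + (n + n) ≡ 2 * n + 2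
    regroup = solve-∀

  P≤M : P ≤ M
  P≤M = ≤-trans (m≤n+m P (2 ^ N)) (≤-reflexive (sym M≡2^N+P))

  2+N<M : 2 + N < M
  2+N<M = <-≤-trans 2+N<P P≤M

  N<M : N < M
  N<M = <-trans (m<n+m N {2} z<s) 2+N<M

  2^N≤M : 2 ^ N ≤ M
  2^N≤M = ≤-trans (m≤m+n (2 ^ N) P) (≤-reflexive (sym M≡2^N+P))

  popcount<2M : ∀ {y} → y < 2 * M → popcount y ≤ 2 + N
  popcount<2M {y} y<2M = popcount<2^ (2 + N) (<-≤-trans y<2M 2M≤2^[2+N])
    where
    2M≤2^[2+N] : 2 * M ≤ 2 ^ (2 + N)
    2M≤2^[2+N] = *-monoʳ-≤ 2 (≤-trans (≤-reflexive M≡2^N+P)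
                   (≤-trans (+-monoʳ-≤ (2 ^ N) (^-monoʳ-≤ 2 (m≤m+n n r))) (≤-reflexive (cong (2 ^ N +_) (sym (+-identityʳ _))))))

  P+P≡2^[1+n] : P + P ≡ 2 ^ suc n
  P+P≡2^[1+n] = cong (P +_) (sym (+-identityʳ P))

  P+P≤2^N : P + P ≤ 2 ^ N
  P+P≤2^N = begin
    P + P       ≡⟨ P+P≡2^[1+n] ⟩
    2 * P       ≤⟨ *-monoˡ-≤ P (^-monoʳ-≤ 2 {1} 1≤r) ⟩
    Q * P       ≡⟨ trans (*-comm Q P) (sym 2^N≡P*Q) ⟩
    2 ^ N       ∎
    where open ≤-Reasoning

  M+2≤T : M + 2 ≤ T
  M+2≤T = begin
    M + 2                 ≡⟨ cong (_+ 2) M≡2^N+P ⟩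
    2 ^ N + P + 2         ≡⟨ +-assoc (2 ^ N) P 2 ⟩
    2 ^ N + (P + 2)       ≤⟨ +-monoʳ-≤ (2 ^ N) (≤-trans (+-monoʳ-≤ P 2≤P) P+P≤2^N) ⟩
    2 ^ N + 2 ^ N         ≡⟨ cong (2 ^ N +_) (sym (+-identityʳ _)) ⟩
    T                     ∎
    where
    open ≤-Reasoning
    2≤P : 2 ≤ P
    2≤P = ^-monoʳ-≤ 2 {1} {n} (≤-trans (s≤s z≤n) 2<n)

  T≤2M : T ≤ 2 * M
  T≤2M = *-monoʳ-≤ 2 2^N≤M

  popcount-1+T : popcount (suc T) ≡ 2
  popcount-1+T = trans (popcount-1+2* (2 ^ N)) (cong suc (popcount-2^ N))

  -- T + 1 has popcount 2, so M (T + 1) + j ∈ S for every 2 ≤ j ≤ T + 1; adding copies of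
  -- M + 1 = s₀ reaches everything above.
  large∈S : ∀ {q ρ} → T ≤ q → ρ ≤ M → InS M (suc M * q + ρ)
  large∈S {q} {ρ} T≤q ρ≤M with m≤n⇒∃[o]m+o≡n T≤q | m≤n⇒∃[o]m+o≡n M+2≤T
  ... | d , refl | e , M+2+e≡T =
    subst (InS M) sum≡ (InS-+ {M} (suc T , 2 + e + ρ , refl , PowSum-between popcount≤ length≤)
                                  (d , d , refl , PowSum-ones d))
    where
    regroup : ∀ M e d ρ → M * suc (M + 2 + e) + (2 + e + ρ) + (M * d + d) ≡ suc M * (M + 2 + e + d) + ρ
    regroup = solve-∀
    sum≡ : M * suc T + (2 + e + ρ) + (M * d + d) ≡ suc M * (T + d) + ρ
    sum≡ = subst (λ t → M * suc t + (2 + e + ρ) + (M * d + d) ≡ suc M * (t + d) + ρ) M+2+e≡T (regroup M e d ρ)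
    popcount≤ : popcount (suc T) ≤ 2 + e + ρ
    popcount≤ = subst (_≤ 2 + e + ρ) (sym popcount-1+T) (m≤m+n 2 (e + ρ))
    length≤ : 2 + e + ρ ≤ suc T
    length≤ = ≤-trans (+-monoʳ-≤ (2 + e) ρ≤M)
                (≤-trans (≤-reflexive (trans (+-comm (2 + e) M) (sym (+-assoc M 2 e))))
                  (≤-trans (≤-reflexive M+2+e≡T) (n≤1+n T)))

  gap<M*[2+T] : ∀ {x} → ¬ InS M x → x < M * (2 + T)
  gap<M*[2+T] {x} x∉S = begin-strict
    x                  ≡⟨ divMod-≡ x (suc M) ⟩
    suc M * q + ρ      <⟨ +-monoʳ-< (suc M * q) (m%n<n x (suc M)) ⟩
    suc M * q + suc M  ≡⟨ trans (+-comm (suc M * q) (suc M)) (sym (*-suc (suc M) q)) ⟩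
    suc M * suc q      ≤⟨ *-monoʳ-≤ (suc M) q<T ⟩
    suc M * T          ≡⟨ +-comm T (M * T) ⟩
    M * T + T          ≤⟨ +-monoʳ-≤ (M * T) T≤2M ⟩
    M * T + 2 * M      ≡⟨ regroup M T ⟩
    M * (2 + T)        ∎
    where
    open ≤-Reasoning
    regroup : ∀ M T → M * T + 2 * M ≡ M * (2 + T)
    regroup = solve-∀
    q ρ : ℕ
    q = x / suc M
    ρ = x % suc M
    q<T : q < T
    q<T with T ≤? q
    ... | no  T≰q = ≰⇒> T≰q
    ... | yes T≤q = ⊥-elim (x∉S (subst (InS M) (sym (divMod-≡ x (suc M))) (large∈S T≤q (s≤s⁻¹ (m%n<n x (suc M))))))

  beyond-window : ∀ {i k} b → k < M → b ≤ k + M → k < popcount b → suc k + M < b + 2 ^ i →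
                  InS M (M * (b + 2 ^ i) + suc k)
  beyond-window zero     _   _     ()  _
  beyond-window {i} {k} (suc b) k<M b≤k+M _ k+M<b+2^i =
    b + 2 ^ i , suc k + M , regroup M b (2 ^ i) k , PowSum-between popcount≤ (s≤s⁻¹ k+M<b+2^i)
    where
    regroup : ∀ M b p k → M * (suc b + p) + suc k ≡ M * (b + p) + (suc k + M)
    regroup = solve-∀
    popcount≤ : popcount (b + 2 ^ i) ≤ suc k + M
    popcount≤ = begin
      popcount (b + 2 ^ i)   ≡⟨ cong popcount (+-comm b (2 ^ i)) ⟩
      popcount (2 ^ i + b)   ≤⟨ popcount-2^+≤ i b ⟩
      suc (popcount b)       ≤⟨ s≤s (popcount<2M b<2M) ⟩
      suc (2 + N)            ≤⟨ 2+N<M ⟩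
      M                      ≤⟨ m≤n+m M (suc k) ⟩
      suc k + M              ∎
      where
      open ≤-Reasoning
      b<2M : b < 2 * M
      b<2M = ≤-<-trans (n≤1+n b) (<-≤-trans (s≤s b≤k+M) (≤-trans (+-monoˡ-≤ M k<M) (≤-reflexive (cong (M +_) (sym (+-identityʳ M))))))

  module _ {x a k} (x≡ : x ≡ M * a + k) (k<M : k < M) where

    shifted≡ : ∀ i → x + (M * 2 ^ i + 1) ≡ M * (a + 2 ^ i) + suc k
    shifted≡ i = trans (cong (_+ (M * 2 ^ i + 1)) x≡) (regroup M a k (2 ^ i))
      where
      regroup : ∀ M a k p → M * a + k + (M * p + 1) ≡ M * (a + p) + suc k
      regroup = solve-∀

    -- Otherwise x = M (a − 1) + (k + M) with popcount (a − 1) small, so x ∈ S.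
    gap⇒a≤k+M : ¬ InS M x → a ≤ k + M
    gap⇒a≤k+M x∉S with a ≤? k + M
    ... | yes a≤k+M = a≤k+M
    ... | no  a≰k+M with m≤n⇒∃[o]m+o≡n (≰⇒> a≰k+M)
    ...   | f , a≡ = ⊥-elim (x∉S (k + M + f , k + M , x≡′ , PowSum-between popcount≤ (m≤m+n (k + M) f)))
      where
      regroup : ∀ M k f → M * suc (k + M + f) + k ≡ M * (k + M + f) + (k + M)
      regroup = solve-∀
      x≡′ : x ≡ M * (k + M + f) + (k + M)
      x≡′ = trans x≡ (trans (cong (λ t → M * t + k) (sym a≡)) (regroup M k f))
      a≤1+T : a ≤ suc T
      a≤1+T = s≤s⁻¹ (*-cancelˡ-< M a (2 + T) (≤-<-trans (≤-trans (m≤m+n (M * a) k) (≤-reflexive (sym x≡))) (gap<M*[2+T] x∉S)))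
      1+T≤2^[2+N] : suc T ≤ 2 ^ (2 + N)
      1+T≤2^[2+N] = ≤-trans (≤-reflexive (+-comm 1 T)) (≤-trans (+-monoʳ-≤ T (m^n>0 2 (suc N))) (≤-reflexive (cong (T +_) (sym (+-identityʳ T)))))
      popcount≤ : popcount (k + M + f) ≤ k + M
      popcount≤ = ≤-trans (popcount<2^ (2 + N) (<-≤-trans (≤-reflexive a≡) (≤-trans a≤1+T 1+T≤2^[2+N])))
                    (≤-trans (<⇒≤ 2+N<M) (m≤n+m M k))

    IsPFℕ⇒PFCriterion : IsPFℕ M x → PFCriterion M a k
    IsPFℕ⇒PFCriterion (x∉S , shifted∈S) = a≤k+M , k<popcount , window-∈S
      where
      a≤k+M : a ≤ k + M
      a≤k+M = gap⇒a≤k+M x∉S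

      shifted-PowSum : ∀ i → a + 2 ^ i ≤ suc k + M → PowSum (a + 2 ^ i) (suc k)
      shifted-PowSum i a+2^i≤ with shifted∈S i
      ... | b , j , eq , s with InS-coords-unique M s (trans (sym eq) (shifted≡ i)) k<M a+2^i≤
      ...   | refl , refl = s

      window-∈S : ∀ i → a + 2 ^ i ≤ suc k + M → popcount (a + 2 ^ i) ≤ suc k
      window-∈S i a+2^i≤ = popcount≤length (shifted-PowSum i a+2^i≤)

      k<popcount : k < popcount a
      k<popcount with popcount a ≤? k
      ... | no  popcount≰k = ≰⇒> popcount≰k
      ... | yes popcount≤k = ⊥-elim (x∉S (a , k , x≡ , PowSum-between popcount≤k k≤a))
        where
        k≤a : k ≤ a
        k≤a = s≤s⁻¹ (≤-trans (PowSum-length≤ (shifted-PowSum 0 (≤-trans (≤-reflexive (+-comm a 1)) (s≤s a≤k+M))))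
                              (≤-reflexive (+-comm a 1)))

    PFCriterion⇒IsPFℕ : PFCriterion M a k → IsPFℕ M x
    PFCriterion⇒IsPFℕ (a≤k+M , k<popcount , window-∈S) = x∉S , shifted∈S
      where
      x∉S : ¬ InS M x
      x∉S (b , j , x≡′ , s) with InS-coords-unique M s (trans (sym x≡′) x≡) (<⇒≤ k<M) a≤k+M
      ... | refl , refl = <⇒≱ k<popcount (popcount≤length s)

      shifted∈S : ∀ i → InS M (x + (M * 2 ^ i + 1))
      shifted∈S i = subst (InS M) (sym (shifted≡ i)) in-coords
        where
        in-coords : InS M (M * (a + 2 ^ i) + suc k)
        in-coords with a + 2 ^ i ≤? suc k + M
        ... | yes a+2^i≤ = a + 2 ^ i , suc k , refl ,
              PowSum-between (window-∈S i a+2^i≤) (≤-trans k<popcount (≤-trans (popcount≤n a) (m≤m+n a (2 ^ i))))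
        ... | no  a+2^i≰ = beyond-window {i} a k<M a≤k+M k<popcount (≰⇒> a+2^i≰)

  instance
    M≢0 : NonZero M
    M≢0 = >-nonZero (<-≤-trans (m^n>0 2 n) P≤M)

  Q≡2*2^pred[r] : Q ≡ 2 * 2 ^ pred r
  Q≡2*2^pred[r] = 2^≡2*2^pred 1≤r

  popcount-Q+1 : popcount (Q + 1) ≡ 2
  popcount-Q+1 = trans (cong popcount (cong (_+ 1) (sym (*-identityʳ Q))))
                       (popcount-2^*+ r 1 (^-monoʳ-≤ 2 1≤r))

  popcount-[Q+1]*2^ : ∀ e → popcount ((Q + 1) * 2 ^ e) ≡ 2
  popcount-[Q+1]*2^ e = trans (cong popcount (*-comm (Q + 1) (2 ^ e))) (trans (popcount-2^* e (Q + 1)) popcount-Q+1)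

  M≡P*[1+2*2^pred[r]] : M ≡ P * (1 + 2 * 2 ^ pred r)
  M≡P*[1+2*2^pred[r]] = trans (*-comm (Q + 1) P) (cong (P *_) (trans (+-comm Q 1) (cong suc Q≡2*2^pred[r])))

  M+4≡4*[1+2*[Q+1]*2^] : ∀ {e} → 3 + e ≡ n → M + 4 ≡ 4 * (1 + 2 * ((Q + 1) * 2 ^ e))
  M+4≡4*[1+2*[Q+1]*2^] {e} 3+e≡n = trans (cong (λ t → (Q + 1) * 2 ^ t + 4) (sym 3+e≡n)) (regroup (Q + 1) (2 ^ e))
    where
    regroup : ∀ q p → q * (2 * (2 * (2 * p))) + 4 ≡ 4 * (1 + 2 * (q * p))
    regroup = solve-∀

  1+n<P : suc n < P
  1+n<P = ≤-trans (s≤s (s≤s (m≤m+n n r))) (<⇒≤ 2+N<P)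

  -- x = M a + k; family₁ k is the paper's i = N − k, family₂ k its j = n + 1 − k.
  data Shape : ℕ → ℕ → Set where
    family₁ : ∀ {k} → n ≤ k → k < N → Shape (allOnes N) k
    family₂ : ∀ {k} → 3 ≤ k → k ≤ n → Shape (pred M) k
    family₃ : Shape (M + 3) 3

  Shape⇒k<M : ∀ {a k} → Shape a k → k < M
  Shape⇒k<M (family₁ _ k<N) = <-trans k<N N<M
  Shape⇒k<M (family₂ _ k≤n) = ≤-<-trans (≤-trans k≤n (m≤m+n n r)) N<M
  Shape⇒k<M family₃         = ≤-<-trans (≤-trans 2<n (m≤m+n n r)) N<M

  Shape⇒Profile : ∀ {a k} → Shape a k → Profile M a k
  Shape⇒Profile (family₁ {k} n≤k k<N) = record
    { R = N ; u = 0 ; δ = P + suc k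
    ; a+1≡ = trans (1+allOnes N) (sym (*-identityʳ _))
    ; a+1+δ≡ = trans (cong (_+ (P + suc k)) (1+allOnes N))
                 (trans (regroup (2 ^ N) P (suc k)) (cong (suc k +_) (sym M≡2^N+P)))
    ; δ<2^R = <-≤-trans (+-monoʳ-< P (<-trans (n<1+n (suc k)) 2+k<P)) P+P≤2^N
    ; gap = k<N
    ; window = λ i 2^i≤ → s≤s (≤-trans (s≤s⁻¹ (2^-cancel-< (≤-<-trans 2^i≤ 1+δ<2^[1+n]))) n≤k)
    }
    where
    regroup : ∀ p P c → p + (P + c) ≡ c + (p + P)
    regroup = solve-∀
    2+k<P : 2 + k < P
    2+k<P = <-trans (s≤s (s≤s k<N)) 2+N<P
    1+δ<2^[1+n] : suc (P + suc k) < 2 ^ suc n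
    1+δ<2^[1+n] = begin-strict
      suc (P + suc k)   ≡⟨ +-suc P (suc k) ⟨
      P + (2 + k)       <⟨ +-monoʳ-< P 2+k<P ⟩
      P + P             ≡⟨ P+P≡2^[1+n] ⟩
      2 ^ suc n         ∎
      where open ≤-Reasoning
  Shape⇒Profile (family₂ {k} 3≤k k≤n) = record
    { R = n ; u = 2 ^ pred r ; δ = suc k
    ; a+1≡ = trans (suc-pred M) M≡P*[1+2*2^pred[r]]
    ; a+1+δ≡ = trans (cong (_+ suc k) (suc-pred M)) (+-comm M (suc k))
    ; δ<2^R = ≤-<-trans (s≤s k≤n) 1+n<P
    ; gap = subst (λ p → suc k ≤ p + n) (sym (popcount-2^ (pred r))) (s≤s k≤n)
    ; window = λ i 2^i≤ → subst (λ p → suc (p + i) ≤ suc k) (sym (popcount-2^ (pred r)))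
                               (4≤⇒2+log≤ i (s≤s 3≤k) 2^i≤)
    }
  Shape⇒Profile family₃ = record
    { R = 2 ; u = (Q + 1) * 2 ^ (n ∸ 3) ; δ = 0
    ; a+1≡ = trans (sym (+-suc M 3)) (M+4≡4*[1+2*[Q+1]*2^] (m+[n∸m]≡n 2<n))
    ; a+1+δ≡ = trans (+-identityʳ _) (trans (sym (+-suc M 3)) (+-comm M 4))
    ; δ<2^R = s≤s z≤n
    ; gap = ≤-reflexive (sym (cong (_+ 2) (popcount-[Q+1]*2^ (n ∸ 3))))
    ; window = window
    }
    where
    window : ∀ i → 2 ^ i ≤ 1 → suc (popcount ((Q + 1) * 2 ^ (n ∸ 3)) + i) ≤ 4
    window zero    _      = ≤-trans (≤-reflexive (cong (λ p → suc (p + 0)) (popcount-[Q+1]*2^ (n ∸ 3)))) (n≤1+n 3)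
    window (suc i) 2^i≤1 = ⊥-elim (<⇒≱ (^-monoʳ-< 2 (s≤s (s≤s z≤n)) (z<s {i})) 2^i≤1)

  module FromProfile {a k} (k<M : k < M) (p : Profile M a k) where
    open Profile p
    open TwoAdic {a} {R} {u} a+1≡

    instance
      2^R≢0 : NonZero (2 ^ R)
      2^R≢0 = m^n≢0 2 R

    1+k+M≡ : suc k + M ≡ 2 ^ R * (1 + 2 * u) + δ
    1+k+M≡ = trans (sym a+1+δ≡) (cong (_+ δ) a+1≡)

    1+k<P : suc k < P
    1+k<P = ≤-<-trans (≤-trans (subst (suc k ≤_) (sym popcount-a) gap) (popcount<2M a<2M)) 2+N<P
      where
      a<2M : a < 2 * M
      a<2M = ≤-trans (m≤m+n (suc a) δ) (≤-trans (≤-reflexive a+1+δ≡)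
               (≤-trans (+-monoˡ-≤ M k<M) (≤-reflexive (cong (M +_) (sym (+-identityʳ M))))))

    -- k + 1 + M = 2ⁿ (Q + 1) + (k + 1) with k + 1 < 2ⁿ, so 1 + 2u = Q + 1 and δ = k + 1.
    R≡n⇒Shape : R ≡ n → Shape a k
    R≡n⇒Shape R≡n with divMod-unique (2 ^ R) (trans (sym 1+k+M≡) 1+k+M≡2^R*[Q+1]+1+k) δ<2^R 1+k<2^R
      where
      1+k+M≡2^R*[Q+1]+1+k : suc k + M ≡ 2 ^ R * (Q + 1) + suc k
      1+k+M≡2^R*[Q+1]+1+k = trans (+-comm (suc k) M) (cong (_+ suc k) (trans (*-comm (Q + 1) P) (cong (λ t → 2 ^ t * (Q + 1)) (sym R≡n))))
      1+k<2^R : suc k < 2 ^ R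
      1+k<2^R = subst (λ t → suc k < 2 ^ t) (sym R≡n) 1+k<P
    ... | 1+2u≡ , refl = subst (λ a → Shape a k) (sym a≡pred[M]) (family₂ (s≤s⁻¹ (2+log≤⇒4≤ window′)) k≤n)
      where
      2u≡Q : 2 * u ≡ Q
      2u≡Q = suc-injective (trans 1+2u≡ (+-comm Q 1))
      popcount-u : popcount u ≡ 1
      popcount-u = trans (sym (popcount-2* u)) (trans (cong popcount 2u≡Q) (popcount-2^ r))
      a≡pred[M] : a ≡ pred M
      a≡pred[M] = cong pred (begin
        suc a                ≡⟨ a+1≡ ⟩
        2 ^ R * (1 + 2 * u)  ≡⟨ cong₂ (λ t q → 2 ^ t * (1 + q)) R≡n 2u≡Q ⟩
        P * (1 + Q)          ≡⟨ trans (cong (P *_) (+-comm 1 Q)) (*-comm P (Q + 1)) ⟩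
        M                    ∎)
        where open ≡-Reasoning
      window′ : ∀ i → 2 ^ i ≤ suc (suc k) → 2 + i ≤ suc k
      window′ i 2^i≤ = subst (λ p → suc (p + i) ≤ suc k) popcount-u (window i 2^i≤)
      k≤n : k ≤ n
      k≤n = s≤s⁻¹ (subst₂ (λ p t → suc k ≤ p + t) popcount-u R≡n gap)

    -- k + 1 + M < 2^(N+1) gives R ≤ N, and then k + 1 + M = 2^R 2^(N−R) + (2ⁿ + k + 1) forces
    -- 1 + 2u = 2^(N−R), i.e. R = N and u = 0.
    n<R⇒Shape : n < R → Shape a k
    n<R⇒Shape n<R with m≤n⇒∃[o]m+o≡n R≤N
      where
      R≤N : R ≤ N
      R≤N with R ≤? N
      ... | yes R≤N = R≤N
      ... | no  R≰N = ⊥-elim (<⇒≱ 1+k+M<T (begin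
        T                           ≤⟨ ^-monoʳ-≤ 2 (≰⇒> R≰N) ⟩
        2 ^ R                       ≤⟨ m≤m*n (2 ^ R) (1 + 2 * u) ⟩
        2 ^ R * (1 + 2 * u)         ≤⟨ m≤m+n _ δ ⟩
        2 ^ R * (1 + 2 * u) + δ     ≡⟨ 1+k+M≡ ⟨
        suc k + M                   ∎))
        where
        open ≤-Reasoning
        1+k+M<T : suc k + M < T
        1+k+M<T = begin-strict
          suc k + M             ≡⟨ cong (suc k +_) M≡2^N+P ⟩
          suc k + (2 ^ N + P)   ≡⟨ regroup (suc k) (2 ^ N) P ⟩
          2 ^ N + (suc k + P)   <⟨ +-monoʳ-< (2 ^ N) (+-monoˡ-< P 1+k<P) ⟩
          2 ^ N + (P + P)       ≤⟨ +-monoʳ-≤ (2 ^ N) P+P≤2^N ⟩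
          2 ^ N + 2 ^ N         ≡⟨ cong (2 ^ N +_) (sym (+-identityʳ (2 ^ N))) ⟩
          T                     ∎
          where
          regroup : ∀ c p P → c + (p + P) ≡ p + (c + P)
          regroup = solve-∀
    ... | g , R+g≡N with divMod-unique (2 ^ R) (trans (sym 1+k+M≡) 1+k+M≡2^R*2^g+P+1+k) δ<2^R P+1+k<2^R
      where
      1+k+M≡2^R*2^g+P+1+k : suc k + M ≡ 2 ^ R * 2 ^ g + (P + suc k)
      1+k+M≡2^R*2^g+P+1+k = begin
        suc k + M                 ≡⟨ cong (suc k +_) M≡2^N+P ⟩
        suc k + (2 ^ N + P)       ≡⟨ regroup (suc k) (2 ^ N) P ⟩
        2 ^ N + (P + suc k)       ≡⟨ cong (λ t → 2 ^ t + (P + suc k)) (sym R+g≡N) ⟩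
        2 ^ (R + g) + (P + suc k) ≡⟨ cong (_+ (P + suc k)) (^-distribˡ-+-* 2 R g) ⟩
        2 ^ R * 2 ^ g + (P + suc k) ∎
        where
        open ≡-Reasoning
        regroup : ∀ c p P → c + (p + P) ≡ p + (P + c)
        regroup = solve-∀
      P+1+k<2^R : P + suc k < 2 ^ R
      P+1+k<2^R = <-≤-trans (+-monoʳ-< P 1+k<P) (≤-trans (≤-reflexive P+P≡2^[1+n]) (^-monoʳ-≤ 2 n<R))
    ... | 1+2u≡2^g , δ≡ with g
    ...   | suc g′ = ⊥-elim (odd≢even u (2 ^ g′) 1+2u≡2^g)
    ...   | zero   = subst (λ a → Shape a k) (sym a≡allOnes) (family₁ n≤k k<N)
      where
      u≡0 : u ≡ 0
      u≡0 = *-cancelˡ-≡ u 0 2 (suc-injective 1+2u≡2^g)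
      R≡N : R ≡ N
      R≡N = trans (sym (+-identityʳ R)) R+g≡N
      a≡allOnes : a ≡ allOnes N
      a≡allOnes = suc-injective (begin
        suc a                ≡⟨ a+1≡ ⟩
        2 ^ R * (1 + 2 * u)  ≡⟨ cong (2 ^ R *_) 1+2u≡2^g ⟩
        2 ^ R * 1            ≡⟨ trans (*-identityʳ (2 ^ R)) (cong (2 ^_) R≡N) ⟩
        2 ^ N                ≡⟨ 1+allOnes N ⟨
        suc (allOnes N)      ∎)
        where open ≡-Reasoning
      n≤k : n ≤ k
      n≤k = s≤s⁻¹ (subst (λ v → suc (popcount v + n) ≤ suc k) u≡0
              (window n (subst (λ d → P ≤ suc d) (sym δ≡) (≤-trans (m≤m+n P (suc k)) (n≤1+n _)))))
      k<N : k < N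
      k<N = subst₂ (λ v t → suc k ≤ popcount v + t) u≡0 R≡N gap

    -- Here 1 + 2u = 2 (Q + 1) 2^e + v is forced, so u has popcount at least 2, and the window
    -- conditions only leave R = 2 and δ = 0.
    module BelowN (e : ℕ) (R+1+e≡n : R + suc e ≡ n) where

      X : ℕ
      X = (Q + 1) * 2 ^ e

      1+k+M≡2^R*[2X+v]+δ′ : suc k + M ≡ 2 ^ R * (2 * X + suc k / 2 ^ R) + suc k % 2 ^ R
      1+k+M≡2^R*[2X+v]+δ′ = begin
        suc k + M
          ≡⟨ cong₂ _+_ (divMod-≡ (suc k) (2 ^ R)) (cong (λ t → (Q + 1) * 2 ^ t) (sym R+1+e≡n)) ⟩
        2 ^ R * (suc k / 2 ^ R) + suc k % 2 ^ R + (Q + 1) * 2 ^ (R + suc e)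
          ≡⟨ cong (λ t → 2 ^ R * (suc k / 2 ^ R) + suc k % 2 ^ R + (Q + 1) * t) (^-distribˡ-+-* 2 R (suc e)) ⟩
        2 ^ R * (suc k / 2 ^ R) + suc k % 2 ^ R + (Q + 1) * (2 ^ R * (2 * 2 ^ e))
          ≡⟨ regroup (2 ^ R) (suc k / 2 ^ R) (suc k % 2 ^ R) (Q + 1) (2 ^ e) ⟩
        2 ^ R * (2 * X + suc k / 2 ^ R) + suc k % 2 ^ R
          ∎
        where
        open ≡-Reasoning
        regroup : ∀ p v d q t → p * v + d + q * (p * (2 * t)) ≡ p * (2 * (q * t) + v) + d
        regroup = solve-∀

      digits : 1 + 2 * u ≡ 2 * X + suc k / 2 ^ R × δ ≡ suc k % 2 ^ R
      digits = divMod-unique (2 ^ R) (trans (sym 1+k+M≡) 1+k+M≡2^R*[2X+v]+δ′) δ<2^R (m%n<n (suc k) (2 ^ R))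

      y : ℕ
      y = proj₁ (odd-split {u} {X} {suc k / 2 ^ R} (proj₁ digits))

      v≡1+2y : suc k / 2 ^ R ≡ 1 + 2 * y
      v≡1+2y = proj₁ (proj₂ (odd-split {u} {X} {suc k / 2 ^ R} (proj₁ digits)))

      u≡X+y : u ≡ X + y
      u≡X+y = proj₂ (proj₂ (odd-split {u} {X} {suc k / 2 ^ R} (proj₁ digits)))

      1+k≡ : suc k ≡ 2 ^ R * (1 + 2 * y) + δ
      1+k≡ = trans (divMod-≡ (suc k) (2 ^ R)) (cong₂ (λ v d → 2 ^ R * v + d) v≡1+2y (sym (proj₂ digits)))

      popcount-u≤ : popcount u ≤ 2 + y
      popcount-u≤ = begin
        popcount u              ≡⟨ cong popcount u≡X+y ⟩
        popcount (X + y)        ≤⟨ popcount-+ X y ⟩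
        popcount X + popcount y ≤⟨ +-mono-≤ (≤-reflexive (popcount-[Q+1]*2^ e)) (popcount≤n y) ⟩
        2 + y                   ∎
        where open ≤-Reasoning

      1≤R : 1 ≤ R
      1≤R = +-cancelˡ-≤ (popcount u) 1 R (≤-trans (≤-reflexive (+-comm (popcount u) 1))
              (≤-trans (≤-trans (≤-reflexive (cong suc (sym (+-identityʳ (popcount u))))) (window 0 (s≤s z≤n))) gap))

      y≡0 : y ≡ 0
      y≡0 = odd-factor-trivial 1≤R (≤-trans (≤-reflexive (sym 1+k≡)) (≤-trans gap (+-monoˡ-≤ R popcount-u≤)))

      u≡X : u ≡ X
      u≡X = trans u≡X+y (trans (cong (X +_) y≡0) (+-identityʳ X))

      popcount-u : popcount u ≡ 2
      popcount-u = trans (cong popcount u≡X) (popcount-[Q+1]*2^ e)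

      1+k≡2^R+δ : suc k ≡ 2 ^ R + δ
      1+k≡2^R+δ = trans 1+k≡ (trans (cong (λ t → 2 ^ R * (1 + 2 * t) + δ) y≡0) (cong (_+ δ) (*-identityʳ (2 ^ R))))

      R≡2×δ≡0 : R ≡ 2 × δ ≡ 0
      R≡2×δ≡0 = excess-window R δ
        (subst (_≤ 2 + R) 1+k≡2^R+δ (subst (λ p → suc k ≤ p + R) popcount-u gap))
        (λ i 2^i≤ → subst (3 + i ≤_) 1+k≡2^R+δ (subst (λ p → suc (p + i) ≤ suc k) popcount-u (window i 2^i≤)))

      k≡3 : k ≡ 3
      k≡3 = suc-injective (trans 1+k≡2^R+δ (cong₂ (λ t d → 2 ^ t + d) (proj₁ R≡2×δ≡0) (proj₂ R≡2×δ≡0)))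

      a≡M+3 : a ≡ M + 3
      a≡M+3 = suc-injective (begin
        suc a                ≡⟨ a+1≡ ⟩
        2 ^ R * (1 + 2 * u)  ≡⟨ cong₂ (λ t v → 2 ^ t * (1 + 2 * v)) (proj₁ R≡2×δ≡0) u≡X ⟩
        4 * (1 + 2 * X)      ≡⟨ M+4≡4*[1+2*[Q+1]*2^] 3+e≡n ⟨
        M + 4                ≡⟨ +-suc M 3 ⟩
        suc (M + 3)          ∎)
        where
        open ≡-Reasoning
        3+e≡n : 3 + e ≡ n
        3+e≡n = subst (λ t → t + suc e ≡ n) (proj₁ R≡2×δ≡0) R+1+e≡n

      shape : Shape a k
      shape = subst₂ Shape (sym a≡M+3) (sym k≡3) family₃

    shape : Shape a k
    shape with <-cmp R n
    ... | tri< R<n _ _ = BelowN.shape (proj₁ (m≤n⇒∃[o]m+o≡n R<n)) (trans (+-suc R _) (proj₂ (m≤n⇒∃[o]m+o≡n R<n)))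
    ... | tri≈ _ R≡n _ = R≡n⇒Shape R≡n
    ... | tri> _ _ n<R = n<R⇒Shape n<R

  Profile⇒Shape : ∀ {a k} → k < M → Profile M a k → Shape a k
  Profile⇒Shape k<M p = FromProfile.shape k<M p

  HasShape : ℕ → Set
  HasShape x = Σ ℕ λ a → Σ ℕ λ k → x ≡ M * a + k × Shape a k

  IsPFℕ⇔HasShape : ∀ x → IsPFℕ M x ⇔ HasShape x
  IsPFℕ⇔HasShape x = mk⇔ to from
    where
    to : IsPFℕ M x → HasShape x
    to pf = x / M , x % M , divMod-≡ x M ,
            Profile⇒Shape (m%n<n x M) (PFCriterion⇒Profile (IsPFℕ⇒PFCriterion (divMod-≡ x M) (m%n<n x M) pf))
    from : HasShape x → IsPFℕ M x
    from (a , k , x≡ , shape) = PFCriterion⇒IsPFℕ x≡ (Shape⇒k<M shape) (Profile⇒PFCriterion (Shape⇒Profile shape))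

  s : ℕ → ℕ
  s = gen (2 ^ r + 1) n

  x+s₀≡ : ∀ {x a k} → x ≡ M * a + k → x + s 0 ≡ M * suc a + suc k
  x+s₀≡ {x} {a} {k} refl = trans (cong (M * a + k +_) (gen≡ 0)) (regroup M a k)
    where
    regroup : ∀ M a k → M * a + k + (M * 1 + 1) ≡ M * suc a + suc k
    regroup = solve-∀

  family₁-value : ∀ {i L} → suc i + L ≡ N → 2 * s i + sumGen (2 ^ r + 1) n (suc i) L ≡ M * 2 ^ N + (2 + L)
  family₁-value {i} {L} 1+i+L≡N = trans (2gen+sumGen≡ i L) (cong (λ t → M * 2 ^ t + (2 + L)) 1+i+L≡N)

  family₂-value : ∀ {j L} → suc j + L ≡ n → 2 * s j + sumGen (2 ^ r + 1) n (suc j) L + s N ≡ M * M + (3 + L)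
  family₂-value {j} {L} 1+j+L≡n = begin
    2 * s j + sumGen (2 ^ r + 1) n (suc j) L + s N  ≡⟨ cong₂ _+_ (2gen+sumGen≡ j L) (gen≡ N) ⟩
    M * 2 ^ (suc j + L) + (2 + L) + (M * 2 ^ N + 1)  ≡⟨ cong (λ t → M * 2 ^ t + (2 + L) + (M * 2 ^ N + 1)) 1+j+L≡n ⟩
    M * P + (2 + L) + (M * 2 ^ N + 1)                ≡⟨ regroup M P (2 ^ N) L ⟩
    M * (2 ^ N + P) + (3 + L)                        ≡⟨ cong (λ t → M * t + (3 + L)) (sym M≡2^N+P) ⟩
    M * M + (3 + L)                                  ∎
    where
    open ≡-Reasoning
    regroup : ∀ M P p L → M * P + (2 + L) + (M * p + 1) ≡ M * (p + P) + (3 + L)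
    regroup = solve-∀

  family₃-value : 2 * s 1 + s n + s N ≡ M * (M + 4) + 4
  family₃-value = begin
    2 * s 1 + s n + s N                                       ≡⟨ cong₂ (λ x y → 2 * x + y + s N) (gen≡ 1) (gen≡ n) ⟩
    2 * (M * 2 + 1) + (M * P + 1) + s N                        ≡⟨ cong (2 * (M * 2 + 1) + (M * P + 1) +_) (gen≡ N) ⟩
    2 * (M * 2 + 1) + (M * P + 1) + (M * 2 ^ N + 1)            ≡⟨ regroup M P (2 ^ N) ⟩
    M * (2 ^ N + P + 4) + 4                                    ≡⟨ cong (λ t → M * (t + 4) + 4) (sym M≡2^N+P) ⟩
    M * (M + 4) + 4                                            ∎
    where
    open ≡-Reasoning
    regroup : ∀ M P p → 2 * (M * 2 + 1) + (M * P + 1) + (M * p + 1) ≡ M * (p + P + 4) + 4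
    regroup = solve-∀

  module _ where
    open import Data.Integer using (+_)
    open Equivalence
    open PseudoFrobenius (2 ^ r + 1) n (m≤n+m 1 Q)

    PFDesc⇒HasShape : ∀ {z} → PFDesc r n z → Σ ℕ λ x → z ≡ + x × HasShape x
    PFDesc⇒HasShape (inj₁ (suc d , s≤s z≤n , 1+d≤r , z≡)) =
      M * allOnes N + suc L , from (≡+⇔≡-+ x+s₀≡V) z≡ , allOnes N , suc L , refl , family₁ n≤1+L 1+L<N
      where
      L : ℕ
      L = N ∸ 1 ∸ suc d
      2+d+L≡N : suc (suc d) + L ≡ N
      2+d+L≡N = +[∸-1-suc] (≤-trans (s≤s 1+d≤r) (≤-trans r<n (m≤m+n n r)))
      x+s₀≡V : M * allOnes N + suc L + s 0 ≡ 2 * s (suc d) + sumGen (2 ^ r + 1) n (suc (suc d)) L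
      x+s₀≡V = trans (x+s₀≡ {a = allOnes N} {k = suc L} refl)
                 (trans (cong (λ t → M * t + suc (suc L)) (1+allOnes N)) (sym (family₁-value 2+d+L≡N)))
      1+L<N : suc L < N
      1+L<N = ≤-trans (s≤s (s≤s (m≤n+m L d))) (≤-reflexive 2+d+L≡N)
      n≤1+L : n ≤ suc L
      n≤1+L = +-cancelʳ-≤ (suc d) n (suc L) (≤-trans (+-monoʳ-≤ n 1+d≤r)
                (≤-reflexive (trans (sym 2+d+L≡N) (trans (+-comm (suc (suc d)) L) (+-suc L (suc d))))))
    PFDesc⇒HasShape (inj₂ (inj₁ (suc d , s≤s z≤n , 1+d≤n∸2 , z≡))) =
      M * pred M + suc (suc L) , from (≡+⇔≡-+ x+s₀≡V) z≡ , pred M , suc (suc L) , refl , family₂ (s≤s (s≤s 1≤L)) 2+L≤n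
      where
      L : ℕ
      L = n ∸ 1 ∸ suc d
      3+d≤n : 3 + d ≤ n
      3+d≤n = ≤-trans (≤-reflexive (+-comm 2 (suc d))) (≤-trans (+-monoˡ-≤ 2 1+d≤n∸2) (≤-reflexive (m∸n+n≡m (<⇒≤ 2<n))))
      2+d+L≡n : suc (suc d) + L ≡ n
      2+d+L≡n = +[∸-1-suc] (≤-trans (n≤1+n _) 3+d≤n)
      x+s₀≡V : M * pred M + suc (suc L) + s 0 ≡ 2 * s (suc d) + sumGen (2 ^ r + 1) n (suc (suc d)) L + s N
      x+s₀≡V = trans (x+s₀≡ {a = pred M} {k = suc (suc L)} refl)
                 (trans (cong (λ t → M * t + suc (suc (suc L))) (suc-pred M)) (sym (family₂-value 2+d+L≡n)))
      1≤L : 1 ≤ L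
      1≤L = +-cancelˡ-≤ (suc (suc d)) 1 L (≤-trans (≤-reflexive (+-comm (suc (suc d)) 1)) (≤-trans 3+d≤n (≤-reflexive (sym 2+d+L≡n))))
      2+L≤n : suc (suc L) ≤ n
      2+L≤n = ≤-trans (s≤s (s≤s (m≤n+m L d))) (≤-reflexive 2+d+L≡n)
    PFDesc⇒HasShape (inj₂ (inj₂ z≡)) =
      M * (M + 3) + 3 , from (≡+⇔≡-+ x+s₀≡V) z≡ , M + 3 , 3 , refl , family₃
      where
      x+s₀≡V : M * (M + 3) + 3 + s 0 ≡ 2 * s 1 + s n + s N
      x+s₀≡V = trans (x+s₀≡ {a = M + 3} {k = 3} refl) (trans (cong (λ t → M * t + 4) (sym (+-suc M 3))) (sym family₃-value))

    HasShape⇒PFDesc : ∀ {z} x → z ≡ + x → HasShape x → PFDesc r n z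
    HasShape⇒PFDesc _ _ (_ , _ , _ , family₁ {zero} n≤0 _) = ⊥-elim (<⇒≱ 2<n (≤-trans n≤0 z≤n))
    HasShape⇒PFDesc _ z≡x (_ , suc L , refl , family₁ n≤1+L 1+L<N) with m≤n⇒∃[o]m+o≡n 1+L<N
    ... | d , 2+L+d≡N = inj₁ (suc d , s≤s z≤n , 1+d≤r , to (≡+⇔≡-+ x+s₀≡V) z≡x)
      where
      2+d+L≡N : suc (suc d) + L ≡ N
      2+d+L≡N = trans (swap d L) 2+L+d≡N
        where
        swap : ∀ d L → suc (suc d) + L ≡ suc (suc L) + d
        swap = solve-∀
      1+d≤r : suc d ≤ r
      1+d≤r = +-cancelˡ-≤ n (suc d) r (≤-trans (+-monoˡ-≤ (suc d) n≤1+L)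
                (≤-reflexive (trans (+-suc (suc L) d) 2+L+d≡N)))
      x+s₀≡V : M * allOnes N + suc L + s 0 ≡ 2 * s (suc d) + sumGen (2 ^ r + 1) n (suc (suc d)) (N ∸ 1 ∸ suc d)
      x+s₀≡V = trans (x+s₀≡ {a = allOnes N} {k = suc L} refl)
                 (trans (cong (λ t → M * t + suc (suc L)) (1+allOnes N))
                   (sym (trans (cong (λ t → 2 * s (suc d) + sumGen (2 ^ r + 1) n (suc (suc d)) t) (∸-1-suc 2+L+d≡N))
                               (family₁-value 2+d+L≡N))))
    HasShape⇒PFDesc _ z≡x (_ , suc (suc L) , refl , family₂ (s≤s (s≤s 1≤L)) 2+L≤n) with m≤n⇒∃[o]m+o≡n 2+L≤n
    ... | d , 2+L+d≡n = inj₂ (inj₁ (suc d , s≤s z≤n , 1+d≤n∸2 , to (≡+⇔≡-+ x+s₀≡V) z≡x))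
      where
      2+d+L≡n : suc (suc d) + L ≡ n
      2+d+L≡n = trans (swap d L) 2+L+d≡n
        where
        swap : ∀ d L → suc (suc d) + L ≡ suc (suc L) + d
        swap = solve-∀
      1+d≤n∸2 : suc d ≤ n ∸ 2
      1+d≤n∸2 = ≤-trans (+-monoˡ-≤ d 1≤L) (≤-reflexive (cong (_∸ 2) 2+L+d≡n))
      x+s₀≡V : M * pred M + suc (suc L) + s 0 ≡ 2 * s (suc d) + sumGen (2 ^ r + 1) n (suc (suc d)) (n ∸ 1 ∸ suc d) + s N
      x+s₀≡V = trans (x+s₀≡ {a = pred M} {k = suc (suc L)} refl)
                 (trans (cong (λ t → M * t + suc (suc (suc L))) (suc-pred M))
                   (sym (trans (cong (λ t → 2 * s (suc d) + sumGen (2 ^ r + 1) n (suc (suc d)) t + s N) (∸-1-suc 2+L+d≡n))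
                               (family₂-value 2+d+L≡n))))
    HasShape⇒PFDesc _ z≡x (_ , _ , refl , family₃) = inj₂ (inj₂ (to (≡+⇔≡-+ x+s₀≡V) z≡x))
      where
      x+s₀≡V : M * (M + 3) + 3 + s 0 ≡ 2 * s 1 + s n + s N
      x+s₀≡V = trans (x+s₀≡ {a = M + 3} {k = 3} refl) (trans (cong (λ t → M * t + 4) (sym (+-suc M 3))) (sym family₃-value))

    IsPF⇔HasShape : ∀ z → IsPF (2 ^ r + 1) n z ⇔ (Σ ℕ λ x → z ≡ + x × HasShape x)
    IsPF⇔HasShape z = mk⇔
      (λ pf → let (x , z≡x , pfℕ) = to (IsPF⇔IsPFℕ z) pf in x , z≡x , to (IsPFℕ⇔HasShape x) pfℕ)
      (λ (x , z≡x , shape) → from (IsPF⇔IsPFℕ z) (x , z≡x , from (IsPFℕ⇔HasShape x) shape))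

    PFDesc⇔HasShape : ∀ z → PFDesc r n z ⇔ (Σ ℕ λ x → z ≡ + x × HasShape x)
    PFDesc⇔HasShape z = mk⇔ PFDesc⇒HasShape (λ (x , z≡x , shape) → HasShape⇒PFDesc x z≡x shape)

  family₁-list family₂-list : List ℕ
  family₁-list = applyUpTo (λ t → M * allOnes N + (n + t)) r
  family₂-list = applyUpTo (λ t → M * pred M + (3 + t)) (n ∸ 2)

  PFs : List ℕ
  PFs = family₁-list ++ family₂-list ++ M * (M + 3) + 3 ∷ []

  n∸2+3≡1+n : n ∸ 2 + 3 ≡ suc n
  n∸2+3≡1+n = trans (+-suc (n ∸ 2) 2) (cong suc (m∸n+n≡m (<⇒≤ 2<n)))

  t<n∸2⇒3+t≤n : ∀ {t} → t < n ∸ 2 → 3 + t ≤ n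
  t<n∸2⇒3+t≤n {t} t<n∸2 =
    s≤s⁻¹ (≤-trans (≤-reflexive (cong suc (+-comm 3 t))) (≤-trans (+-monoˡ-≤ 3 t<n∸2) (≤-reflexive n∸2+3≡1+n)))

  3+t≤n⇒t<n∸2 : ∀ {t} → 3 + t ≤ n → t < n ∸ 2
  3+t≤n⇒t<n∸2 {t} 3+t≤n = m+n≤o⇒m≤o∸n (suc t) (≤-trans (≤-reflexive (+-comm (suc t) 2)) 3+t≤n)

  ∈PFs⇔HasShape : ∀ {x} → x ∈ PFs ⇔ HasShape x
  ∈PFs⇔HasShape {x} = mk⇔ to from
    where
    to : x ∈ PFs → HasShape x
    to x∈ with ∈-++⁻ family₁-list x∈
    ... | inj₁ x∈₁ with ∈-applyUpTo⁻ _ x∈₁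
    ...   | t , t<r , refl = allOnes N , n + t , refl , family₁ (m≤m+n n t) (+-monoʳ-< n t<r)
    to x∈ | inj₂ x∈′ with ∈-++⁻ family₂-list x∈′
    ... | inj₁ x∈₂ with ∈-applyUpTo⁻ _ x∈₂
    ...   | t , t<n∸2 , refl = pred M , 3 + t , refl , family₂ (m≤m+n 3 t) (t<n∸2⇒3+t≤n t<n∸2)
    to x∈ | inj₂ x∈′ | inj₂ (here refl) = M + 3 , 3 , refl , family₃
    from : HasShape x → x ∈ PFs
    from (_ , k , refl , family₁ n≤k k<N) =
      ∈-++⁺ˡ (subst (λ t → M * allOnes N + t ∈ family₁-list) (m+[n∸m]≡n n≤k)
        (∈-applyUpTo⁺ (λ t → M * allOnes N + (n + t)) (+-cancelˡ-< n (k ∸ n) r (subst (_< N) (sym (m+[n∸m]≡n n≤k)) k<N))))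
    from (_ , k , refl , family₂ 3≤k k≤n) =
      ∈-++⁺ʳ family₁-list (∈-++⁺ˡ (subst (λ t → M * pred M + t ∈ family₂-list) (m+[n∸m]≡n 3≤k)
        (∈-applyUpTo⁺ (λ t → M * pred M + (3 + t)) (3+t≤n⇒t<n∸2 (≤-trans (≤-reflexive (m+[n∸m]≡n 3≤k)) k≤n)))))
    from (_ , _ , refl , family₃) = ∈-++⁺ʳ family₁-list (∈-++⁺ʳ family₂-list (here refl))

  PFs-increasing : AllPairs _<_ PFs
  PFs-increasing =
    AllPairsₚ.++⁺ (AllPairsₚ.applyUpTo⁺₁ _ r (λ i<j _ → +-monoʳ-< (M * allOnes N) (+-monoʳ-< n i<j)))
      (AllPairsₚ.++⁺ (AllPairsₚ.applyUpTo⁺₁ _ (n ∸ 2) (λ i<j _ → +-monoʳ-< (M * pred M) (+-monoʳ-< 3 i<j)))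
                    (All.[] ∷ [])
                    (All.tabulate (λ y∈ → family₂<last y∈ All.∷ All.[])))
      (All.tabulate (λ y∈ → All.tabulate (λ z∈ → <-≤-trans (family₁<M*pred[M] y∈) (M*pred[M]≤rest z∈))))
    where
    M*pred[M]+M≡M*M : M * pred M + M ≡ M * M
    M*pred[M]+M≡M*M = trans (+-comm (M * pred M) M) (trans (sym (*-suc M (pred M))) (cong (M *_) (suc-pred M)))
    family₁<M*pred[M] : ∀ {y} → y ∈ family₁-list → y < M * pred M
    family₁<M*pred[M] y∈ with ∈-applyUpTo⁻ _ y∈
    ... | t , t<r , refl = begin-strict
      M * allOnes N + (n + t)   <⟨ +-monoʳ-< (M * allOnes N) (<-trans (+-monoʳ-< n t<r) N<M) ⟩
      M * allOnes N + M         ≡⟨ trans (+-comm (M * allOnes N) M) (sym (*-suc M (allOnes N))) ⟩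
      M * suc (allOnes N)       ≡⟨ cong (M *_) (1+allOnes N) ⟩
      M * 2 ^ N                 ≤⟨ *-monoʳ-≤ M 2^N≤pred[M] ⟩
      M * pred M                ∎
      where
      open ≤-Reasoning
      2^N≤pred[M] : 2 ^ N ≤ pred M
      2^N≤pred[M] = pred-mono-≤ (<-≤-trans (m<m+n (2 ^ N) (m^n>0 2 n)) (≤-reflexive (sym M≡2^N+P)))
    M*pred[M]≤rest : ∀ {z} → z ∈ family₂-list ++ M * (M + 3) + 3 ∷ [] → M * pred M ≤ z
    M*pred[M]≤rest z∈ with ∈-++⁻ family₂-list z∈
    ... | inj₁ z∈₂ with ∈-applyUpTo⁻ _ z∈₂
    ...   | t , _ , refl = m≤m+n (M * pred M) (3 + t)
    M*pred[M]≤rest z∈ | inj₂ (here refl) = ≤-trans (*-monoʳ-≤ M (≤-trans pred[n]≤n (m≤m+n M 3))) (m≤m+n _ 3)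
    family₂<last : ∀ {y} → y ∈ family₂-list → y < M * (M + 3) + 3
    family₂<last y∈ with ∈-applyUpTo⁻ _ y∈
    ... | t , t<n∸2 , refl = begin-strict
      M * pred M + (3 + t)   <⟨ +-monoʳ-< (M * pred M) 3+t<M ⟩
      M * pred M + M         ≡⟨ M*pred[M]+M≡M*M ⟩
      M * M                  ≤⟨ *-monoʳ-≤ M (m≤m+n M 3) ⟩
      M * (M + 3)            ≤⟨ m≤m+n _ 3 ⟩
      M * (M + 3) + 3        ∎
      where
      open ≤-Reasoning
      3+t<M : 3 + t < M
      3+t<M = ≤-<-trans (t<n∸2⇒3+t≤n t<n∸2) (≤-<-trans (m≤m+n n r) N<M)

  length-PFs : length PFs ≡ n + r ∸ 1
  length-PFs = begin
    length PFs                                  ≡⟨ length-++ family₁-list ⟩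
    length family₁-list + length (family₂-list ++ M * (M + 3) + 3 ∷ [])
                                                ≡⟨ cong₂ _+_ (length-applyUpTo _ r) (trans (length-++ family₂-list) (cong (_+ 1) (length-applyUpTo _ (n ∸ 2)))) ⟩
    r + (n ∸ 2 + 1)                             ≡⟨ count n r 2<n ⟩
    n + r ∸ 1                                   ∎
    where
    open ≡-Reasoning
    count : ∀ n r → 2 < n → r + (n ∸ 2 + 1) ≡ n + r ∸ 1
    count 1             r (s≤s ())
    count (suc (suc n)) r _ = regroup n r
      where
      regroup : ∀ n r → r + (n + 1) ≡ suc (n + r)
      regroup = solve-∀

  module _ where
    open import Data.Integer using (+_)
    open Equivalence

    ∈+PFs⇔HasShape : ∀ z → z ∈ map +_ PFs ⇔ (Σ ℕ λ x → z ≡ + x × HasShape x)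
    ∈+PFs⇔HasShape z = mk⇔
      (λ z∈ → let (x , x∈ , z≡x) = ∈-map⁻ +_ z∈ in x , z≡x , to ∈PFs⇔HasShape x∈)
      (λ (x , z≡x , shape) → subst (_∈ map +_ PFs) (sym z≡x) (∈-map⁺ +_ (from ∈PFs⇔HasShape shape)))

open import Data.Integer using (+_)

theorem8 : (n r : ℕ) → 2 < n → 1 ≤ r → 2 ^ r + 1 < 2 ^ n →
    ((z : ℤ) → IsPF (2 ^ r + 1) n z ⇔ PFDesc r n z)
    × (Σ (List ℤ) λ L → Unique L × (length L ≡ n + r ∸ 1)
         × ((z : ℤ) → IsPF (2 ^ r + 1) n z ⇔ z ∈ L))
theorem8 n r 2<n 1≤r 2^r+1<2^n =
  (λ z → ⇔.trans (IsPF⇔HasShape z) (⇔.sym (PFDesc⇔HasShape z))) ,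
  map +_ PFs ,
  Unique.map⁺ ℤP.+-injective (AllPairs.map <⇒≢ PFs-increasing) ,
  trans (length-map +_ PFs) length-PFs ,
  (λ z → ⇔.trans (IsPF⇔HasShape z) (⇔.sym (∈+PFs⇔HasShape z)))
  where open Classification n r 2<n 1≤r 2^r+1<2^n
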